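{- Let $n\ge1$ and $\alpha$ a Dyck path of length $2n$. Then \[\sum_{w\in\mathfrak{S}_{2n}:\,p_A(w)=\alpha} q^{aa(w)}t^{z(w)}=[2]_t[4]_t[6]_t\cdots[2n]_t\prod_{i=1}^n[h_i(\alpha)]_q,\] where $q,t$ are formal variables and $[h]_q=1+q+\dots+q^{h-1}$.
   Context: A Dyck path of length $2N$ is a lattice path from $(0,0)$ to $(2N,0)$ with steps $(1,1)$ (up) and $(1,-1)$ (down) staying weakly above the $x$-axis; the down step ending at $x$-coordinate $k$ and going from height $h$ to $h-1$ is at position $k$ with height $h$; the path is determined by its set of down-step positions. $h_i(p)$ is the height of the $i$th down step of $p$. Crossout procedure: for $w\in\mathfrak{S}_{2n}$ in one-line notation, repeat until all positions are marked: mark "B" at the unmarked position $i$ with smallest value $w(i)$, then mark "A" at the leftmost unmarked position. $\mathcal{A}(w)$, $\mathcal{B}(w)$ are the sets of positions marked A and B. $p_A(w)$ is the Dyck path of length $2n$ with down-step positions $\{w(a):a\in\mathcal{A}(w)\}$. $aa(w)$ is the number of pairs of positions $i<j$, both marked A, with $w(i)>w(j)$. $z(w)=\#\{(i,j): i<j,\ w(i)<w(j),\ i\in\mathcal{B}(w)\}$. -}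

module Defs where

open import Data.Nat using (ℕ; zero; suc; _∸_; _<ᵇ_; _≡ᵇ_)
import Data.Nat as ℕ
open import Data.Bool using (Bool; true; false; not; _∧_)
open import Data.List using (List; []; _∷_; map; concatMap; filterᵇ; length; zip; upTo; filter; foldr)
open import Data.List.Properties using (≡-dec)
open import Data.Maybe using (Maybe; just; nothing)
open import Data.Product using (_×_; _,_; proj₁; proj₂)
open import Relation.Binary.PropositionalEquality using (_≡_)
open import Relation.Nullary using (yes; no)
open import Data.List.Relation.Unary.Unique.DecPropositional ℕ._≟_ using (unique?)
open import Algebra.Bundles using (CommutativeSemiring)
import Data.Bool as B
open import Data.Bool.ListAction using (any)

words : ℕ → List ℕ → List (List ℕ)
words zero    xs = [] ∷ []
words (suc k) xs = concatMap (λ x → map (x ∷_) (words k xs)) xs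

range1 : ℕ → List ℕ
range1 m = map suc (upTo m)

perms : ℕ → List (List ℕ)
perms m = filter unique? (words m (range1 m))

data Mark : Set where
  unm mA mB : Mark

isA : Mark → Bool
isA mA = true
isA _  = false

isB : Mark → Bool
isB mB = true
isB _  = false

isUnm : Mark → Bool
isUnm unm = true
isUnm _   = false

-- 0-based index of an unmarked position with smallest value
argminGo : ℕ → List (ℕ × Mark) → Maybe (ℕ × ℕ) → Maybe (ℕ × ℕ)
argminGo i []              best = best
argminGo i ((v , unm) ∷ r) nothing = argminGo (suc i) r (just (i , v))
argminGo i ((v , unm) ∷ r) (just (j , u)) with v <ᵇ u
... | true  = argminGo (suc i) r (just (i , v))
... | false = argminGo (suc i) r (just (j , u))
argminGo i ((v , _) ∷ r) best = argminGo (suc i) r best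

argminUnmarked : List ℕ → List Mark → Maybe ℕ
argminUnmarked w ms with argminGo 0 (zip w ms) nothing
... | nothing      = nothing
... | just (i , _) = just i

firstUnmarked : List Mark → Maybe ℕ
firstUnmarked []          = nothing
firstUnmarked (unm ∷ ms)  = just 0
firstUnmarked (_ ∷ ms) with firstUnmarked ms
... | nothing = nothing
... | just i  = just (suc i)

setAt : Maybe ℕ → Mark → List Mark → List Mark
setAt nothing        m ms       = ms
setAt (just _)       m []       = []
setAt (just zero)    m (_ ∷ ms) = m ∷ ms
setAt (just (suc i)) m (x ∷ ms) = x ∷ setAt (just i) m ms

crossRound : List ℕ → List Mark → List Mark
crossRound w ms = let ms′ = setAt (argminUnmarked w ms) mB ms
                  in setAt (firstUnmarked ms′) mA ms′

iterRounds : ℕ → List ℕ → List Mark → List Mark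
iterRounds zero    w ms = ms
iterRounds (suc k) w ms = iterRounds k w (crossRound w ms)

-- marks of all positions of w (length w rounds is more than enough;
-- rounds after everything is marked change nothing)
crossout : List ℕ → List Mark
crossout w = iterRounds (length w) w (map (λ _ → unm) w)

marked : List ℕ → List (ℕ × Mark)
marked w = zip w (crossout w)

countPairs : {A : Set} → (A → A → Bool) → List A → ℕ
countPairs P []       = 0
countPairs P (x ∷ xs) = length (filterᵇ (P x) xs) ℕ.+ countPairs P xs

aa : List ℕ → ℕ
aa w = countPairs (λ x y → isA (proj₂ x) ∧ isA (proj₂ y) ∧ (proj₁ y <ᵇ proj₁ x)) (marked w)

zstat : List ℕ → ℕ
zstat w = countPairs (λ x y → isB (proj₂ x) ∧ (proj₁ x <ᵇ proj₁ y)) (marked w)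

-- Dyck paths as step sequences (true = up step, false = down step)

data DyckFrom : ℕ → List Bool → Set where
  done : DyckFrom 0 []
  up   : ∀ {h s} → DyckFrom (suc h) s → DyckFrom h (true ∷ s)
  down : ∀ {h s} → DyckFrom h s → DyckFrom (suc h) (false ∷ s)

IsDyck : List Bool → Set
IsDyck s = DyckFrom 0 s

-- heights h_1, h_2, … of the down steps (height before the step), starting at height h
downHeightsFrom : ℕ → List Bool → List ℕ
downHeightsFrom h []            = []
downHeightsFrom h (true  ∷ s)   = downHeightsFrom (suc h) s
downHeightsFrom h (false ∷ s)   = h ∷ downHeightsFrom (h ∸ 1) s

downHeights : List Bool → List ℕ
downHeights = downHeightsFrom 0

-- p_A(w): the path of length (length w) whose down steps are at the
-- positions {w(a) : a marked A}
pathA : List ℕ → List Bool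
pathA w = map (λ k → not (any (λ v → k ≡ᵇ v) Avals)) (range1 (length w))
  where Avals = map proj₁ (filterᵇ (λ x → isA (proj₂ x)) (marked w))

module _ {c ℓ} (R : CommutativeSemiring c ℓ) where
  open CommutativeSemiring R

  pow : Carrier → ℕ → Carrier
  pow x zero    = 1#
  pow x (suc k) = x * pow x k

  sumR : List Carrier → Carrier
  sumR = foldr _+_ 0#

  prodR : List Carrier → Carrier
  prodR = foldr _*_ 1#

  qint : Carrier → ℕ → Carrier
  qint x h = sumR (map (pow x) (upTo h))

  lhs : Carrier → Carrier → ℕ → List Bool → Carrier
  lhs q t n α = sumR (map (λ w → pow q (aa w) * pow t (zstat w))
                          (filter (λ w → ≡-dec B._≟_ (pathA w) α) (perms (2 ℕ.* n))))

  rhs : Carrier → Carrier → ℕ → List Bool → Carrier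
  rhs q t n α = prodR (map (λ k → qint t (2 ℕ.* suc k)) (upTo n))
              * prodR (map (qint q) (downHeights α))

-- The least value s of w is crossed out first: it gets B and the leftmost other entry y gets A.
-- Marked entries are inert, so the rest of the crossout is that of the word v obtained by
-- deleting s and y. As s is smaller than every other value, z(w) = z(v) + #(entries after s)
-- and aa(w) = aa(v) + #(A-values of v below y); summing over the position of s gives [2n]_t.
-- In p_A(w) the value s is an up step and y a down step, and the A-values of v below y are
-- exactly the down steps before it, so summing over y is the recursion [h + 1]_q = 1 + q [h]_q
-- behind ∏ [h_i]_q. The induction runs over arbitrary sorted value lists in place of 1, …, 2n.

module Submission where

open import Algebra.Bundles using (CommutativeSemiring)
open import Data.Bool as Bool using (Bool; true; false; not; _∧_; _∨_; T; T?; if_then_else_)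
open import Data.Bool.ListAction using (any)
open import Data.Bool.Properties using (not-involutive; ∧-zeroʳ)
open import Data.List using (List; []; _∷_; _++_; map; length; zip; filterᵇ; filter; concatMap; upTo)
open import Data.List.Membership.Propositional using (_∈_)
open import Data.List.Membership.Propositional.Properties using (∈-++⁻; ∈-filter⁻; ∈-filter⁺)
open import Data.List.Properties
  using (≡-dec; length-upTo; length-++-sucʳ; length-map; map-++; map-cong-local; ∷-injective; map-upTo; upTo-∷ʳ)
open import Data.List.Relation.Unary.All as All using (All; []; _∷_)
open import Data.List.Relation.Unary.All.Properties using (All¬⇒¬Any; concat⁺; map⁺; ++⁺; ++⁻ˡ; ++⁻ʳ)
open import Data.List.Relation.Unary.AllPairs as AllPairs using (AllPairs)
import Data.List.Relation.Unary.AllPairs.Properties as AllPairs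
open import Data.List.Relation.Unary.Any using (here; there)
open import Data.List.Relation.Unary.Unique.Propositional using (Unique; []; _∷_)
import Data.List.Relation.Unary.Unique.Propositional.Properties as Unique
open import Data.Maybe as Maybe using (Maybe; just; nothing)
import Data.Maybe.Properties as Maybe
open import Data.Nat as ℕ using (ℕ; zero; suc; _≤_; _<_; z≤n; s≤s; _<ᵇ_; _≡ᵇ_; _∸_)
import Data.Nat.Properties as ℕ
open import Data.Product using (_×_; _,_; proj₁; proj₂)
open import Data.Sum using (_⊎_; inj₁; inj₂)
open import Data.Unit using (⊤; tt)
open import Function using (_∘_)
import Relation.Binary.PropositionalEquality as ≡
open ≡ using (_≡_)
open import Relation.Nullary using (¬_; ¬?; Dec; does; yes; no)
open import Relation.Nullary.Decidable using (dec-true; dec-false)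
open import Defs

module Combinatorics where

  open ≡
  open import Data.Nat.Properties
    using ( ≤-refl; m≤n⇒m≤1+n; +-suc; +-identityʳ; suc-injective; <-asym; <-irrefl; <⇒≢; _<?_; _≟_
          ; +-commutativeSemigroup)
  open import Data.List.Membership.DecPropositional _≟_ using (_∈?_)
  open import Algebra.Properties.CommutativeSemigroup +-commutativeSemigroup
    using () renaming (x∙yz≈y∙xz to m+[n+o]≡n+[m+o])

  private variable A B : Set

  <ᵇ-true : ∀ {m n} → m < n → (m <ᵇ n) ≡ true
  <ᵇ-true {m} {n} = dec-true (m <? n)

  <ᵇ-false : ∀ {m n} → m < n → (n <ᵇ m) ≡ false
  <ᵇ-false {m} {n} m<n = dec-false (n <? m) (<-asym m<n)

  ≡ᵇ-refl : ∀ n → (n ≡ᵇ n) ≡ true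
  ≡ᵇ-refl n = dec-true (n ≟ n) refl

  ≢⇒≡ᵇ-false : ∀ {m n} → ¬ m ≡ n → (m ≡ᵇ n) ≡ false
  ≢⇒≡ᵇ-false {m} {n} = dec-false (m ≟ n)

  insertAt : ℕ → A → List A → List A
  insertAt zero    a xs       = a ∷ xs
  insertAt (suc p) a []       = a ∷ []
  insertAt (suc p) a (x ∷ xs) = x ∷ insertAt p a xs

  map-insertAt : (f : A → B) (p : ℕ) (a : A) (xs : List A) →
                 map f (insertAt p a xs) ≡ insertAt p (f a) (map f xs)
  map-insertAt f zero    a xs       = refl
  map-insertAt f (suc p) a []       = refl
  map-insertAt f (suc p) a (x ∷ xs) = cong (f x ∷_) (map-insertAt f p a xs)

  zip-insertAt : (p : ℕ) (a : A) (b : B) (xs : List A) (ys : List B) →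
                 length xs ≡ length ys → p ≤ length ys →
                 zip (insertAt p a xs) (insertAt p b ys) ≡ insertAt p (a , b) (zip xs ys)
  zip-insertAt zero    a b xs       ys       _  _       = refl
  zip-insertAt (suc p) a b (x ∷ xs) (y ∷ ys) eq (s≤s h) =
    cong ((x , y) ∷_) (zip-insertAt p a b xs ys (suc-injective eq) h)

  -- The position that index j moves to when an entry is inserted at position c.
  punchIn : ℕ → ℕ → ℕ
  punchIn zero    j       = suc j
  punchIn (suc c) zero    = zero
  punchIn (suc c) (suc j) = suc (punchIn c j)

  punchIn-≥ : ∀ c j → c ≤ j → punchIn c j ≡ suc j
  punchIn-≥ zero    j       _       = refl
  punchIn-≥ (suc c) (suc j) (s≤s h) = cong suc (punchIn-≥ c j h)

  punchIn-< : ∀ c j → j < c → punchIn c j ≡ j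
  punchIn-< (suc c) zero    _       = refl
  punchIn-< (suc c) (suc j) (s≤s h) = cong suc (punchIn-< c j h)

  data Marked : Mark → Set where
    markedA : Marked mA
    markedB : Marked mB

  unmarkedOrMarked : ∀ m → m ≡ unm ⊎ Marked m
  unmarkedOrMarked unm = inj₁ refl
  unmarkedOrMarked mA  = inj₂ markedA
  unmarkedOrMarked mB  = inj₂ markedB

  -- The best-so-far (index , value) of argminGo.
  Best : Set
  Best = Maybe (ℕ × ℕ)

  punchInBest : ℕ → Best → Best
  punchInBest c = Maybe.map (λ (j , u) → punchIn c j , u)

  IndexBelow : ℕ → Best → Set
  IndexBelow i nothing        = ⊤
  IndexBelow i (just (j , _)) = j < i

  ValueAbove : ℕ → Best → Set
  ValueAbove m nothing        = ⊤
  ValueAbove m (just (_ , u)) = m < u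

  punchIn-IndexBelow : ∀ c b → IndexBelow c b → punchInBest c b ≡ b
  punchIn-IndexBelow c nothing        _ = refl
  punchIn-IndexBelow c (just (j , u)) h = cong (λ k → just (k , u)) (punchIn-< c j h)

  IndexBelow-suc : ∀ i b → IndexBelow i b → IndexBelow (suc i) b
  IndexBelow-suc i nothing        _ = tt
  IndexBelow-suc i (just (j , _)) h = m≤n⇒m≤1+n h

  mutual
    argminGo-punchIn : ∀ c i L b → c ≤ i →
                       argminGo (suc i) L (punchInBest c b) ≡ punchInBest c (argminGo i L b)
    argminGo-punchIn c i []              b              c≤i = refl
    argminGo-punchIn c i ((v , unm) ∷ L) nothing        c≤i = argminGo-punchIn-fresh c i L v c≤i
    argminGo-punchIn c i ((v , unm) ∷ L) (just (j , u)) c≤i with v <ᵇ u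
    ... | true  = argminGo-punchIn-fresh c i L v c≤i
    ... | false = argminGo-punchIn c (suc i) L (just (j , u)) (m≤n⇒m≤1+n c≤i)
    argminGo-punchIn c i ((v , mA) ∷ L)  b c≤i = argminGo-punchIn c (suc i) L b (m≤n⇒m≤1+n c≤i)
    argminGo-punchIn c i ((v , mB) ∷ L)  b c≤i = argminGo-punchIn c (suc i) L b (m≤n⇒m≤1+n c≤i)

    argminGo-punchIn-fresh : ∀ c i L v → c ≤ i →
      argminGo (suc (suc i)) L (just (suc i , v)) ≡ punchInBest c (argminGo (suc i) L (just (i , v)))
    argminGo-punchIn-fresh c i L v c≤i =
      subst (λ k → argminGo (suc (suc i)) L (just (k , v)) ≡ punchInBest c (argminGo (suc i) L (just (i , v))))
            (punchIn-≥ c i c≤i) (argminGo-punchIn c (suc i) L (just (i , v)) (m≤n⇒m≤1+n c≤i))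

  argminGo-skip : ∀ {mk} → Marked mk → ∀ i a L b → argminGo i ((a , mk) ∷ L) b ≡ argminGo (suc i) L b
  argminGo-skip markedA i a L b = refl
  argminGo-skip markedB i a L b = refl

  argminGo-insertAt-marked : ∀ {mk} → Marked mk → ∀ a p i L b → p ≤ length L → IndexBelow i b →
                             argminGo i (insertAt p (a , mk) L) b ≡ punchInBest (i ℕ.+ p) (argminGo i L b)
  argminGo-insertAt-marked mk a zero i L b _ below rewrite argminGo-skip mk i a L b | +-identityʳ i =
    trans (cong (argminGo (suc i) L) (sym (punchIn-IndexBelow i b below))) (argminGo-punchIn i i L b ≤-refl)
  argminGo-insertAt-marked mk a (suc p) i ((v , unm) ∷ L) nothing (s≤s h) _ rewrite +-suc i p =
    argminGo-insertAt-marked mk a p (suc i) L (just (i , v)) h ≤-refl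
  argminGo-insertAt-marked mk a (suc p) i ((v , unm) ∷ L) (just (j , u)) (s≤s h) below with v <ᵇ u
  ... | true  rewrite +-suc i p = argminGo-insertAt-marked mk a p (suc i) L (just (i , v)) h ≤-refl
  ... | false rewrite +-suc i p = argminGo-insertAt-marked mk a p (suc i) L (just (j , u)) h (m≤n⇒m≤1+n below)
  argminGo-insertAt-marked mk a (suc p) i ((v , mA) ∷ L) b (s≤s h) below rewrite +-suc i p =
    argminGo-insertAt-marked mk a p (suc i) L b h (IndexBelow-suc i b below)
  argminGo-insertAt-marked mk a (suc p) i ((v , mB) ∷ L) b (s≤s h) below rewrite +-suc i p =
    argminGo-insertAt-marked mk a p (suc i) L b h (IndexBelow-suc i b below)

  unmarked : List ℕ → List (ℕ × Mark)
  unmarked = map (_, unm)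

  argminGo-keeps-minimum : ∀ m j i u → All (m <_) u → argminGo i (unmarked u) (just (j , m)) ≡ just (j , m)
  argminGo-keeps-minimum m j i []      _        = refl
  argminGo-keeps-minimum m j i (x ∷ u) (m<x ∷ h) rewrite <ᵇ-false m<x = argminGo-keeps-minimum m j (suc i) u h

  argminGo-insertAt-minimum : ∀ m p i u b → All (m <_) u → ValueAbove m b → p ≤ length u →
                              argminGo i (insertAt p (m , unm) (unmarked u)) b ≡ just (i ℕ.+ p , m)
  argminGo-insertAt-minimum m zero i u nothing h _ _ rewrite +-identityʳ i =
    argminGo-keeps-minimum m i (suc i) u h
  argminGo-insertAt-minimum m zero i u (just (j , u′)) h above _ rewrite <ᵇ-true above | +-identityʳ i =
    argminGo-keeps-minimum m i (suc i) u h
  argminGo-insertAt-minimum m (suc p) i (x ∷ u) nothing (m<x ∷ h) _ (s≤s hp) rewrite +-suc i p =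
    argminGo-insertAt-minimum m p (suc i) u (just (i , x)) h m<x hp
  argminGo-insertAt-minimum m (suc p) i (x ∷ u) (just (j , u′)) (m<x ∷ h) above (s≤s hp) with x <ᵇ u′
  ... | true  rewrite +-suc i p = argminGo-insertAt-minimum m p (suc i) u (just (i , x)) h m<x hp
  ... | false rewrite +-suc i p = argminGo-insertAt-minimum m p (suc i) u (just (j , u′)) h above hp

  setAt-insertAt : ∀ p k x (ms : List Mark) → p ≤ length ms →
                   setAt (just p) k (insertAt p x ms) ≡ insertAt p k ms
  setAt-insertAt zero    k x ms       _       = refl
  setAt-insertAt (suc p) k x (m ∷ ms) (s≤s h) = cong (m ∷_) (setAt-insertAt p k x ms h)

  setAt-punchIn : ∀ p k x (ms : List Mark) i → p ≤ length ms →
                  setAt (Maybe.map (punchIn p) i) k (insertAt p x ms) ≡ insertAt p x (setAt i k ms)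
  setAt-punchIn p       k x ms       nothing        _       = refl
  setAt-punchIn zero    k x ms       (just j)       _       = refl
  setAt-punchIn (suc p) k x (m ∷ ms) (just zero)    (s≤s h) = refl
  setAt-punchIn (suc p) k x (m ∷ ms) (just (suc j)) (s≤s h) = cong (m ∷_) (setAt-punchIn p k x ms (just j) h)

  length-setAt : ∀ i k (ms : List Mark) → length (setAt i k ms) ≡ length ms
  length-setAt nothing        k ms       = refl
  length-setAt (just _)       k []       = refl
  length-setAt (just zero)    k (_ ∷ ms) = refl
  length-setAt (just (suc i)) k (_ ∷ ms) = cong suc (length-setAt (just i) k ms)

  firstUnmarked-marked-∷ : ∀ {mk} → Marked mk → ∀ ms →
                           firstUnmarked (mk ∷ ms) ≡ Maybe.map suc (firstUnmarked ms)
  firstUnmarked-marked-∷ markedA ms with firstUnmarked ms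
  ... | nothing = refl
  ... | just i  = refl
  firstUnmarked-marked-∷ markedB ms with firstUnmarked ms
  ... | nothing = refl
  ... | just i  = refl

  firstUnmarked-insertAt-marked : ∀ {mk} → Marked mk → ∀ p ms → p ≤ length ms →
                                  firstUnmarked (insertAt p mk ms) ≡ Maybe.map (punchIn p) (firstUnmarked ms)
  firstUnmarked-insertAt-marked mk zero ms _ = firstUnmarked-marked-∷ mk ms
  firstUnmarked-insertAt-marked mk (suc p) (m ∷ ms) (s≤s h) with unmarkedOrMarked m
  ... | inj₁ refl = refl
  ... | inj₂ m-marked = begin
    firstUnmarked (m ∷ insertAt p _ ms)
      ≡⟨ firstUnmarked-marked-∷ m-marked _ ⟩
    Maybe.map suc (firstUnmarked (insertAt p _ ms))
      ≡⟨ cong (Maybe.map suc) (firstUnmarked-insertAt-marked mk p ms h) ⟩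
    Maybe.map suc (Maybe.map (punchIn p) (firstUnmarked ms))
      ≡⟨ Maybe.map-∘ (firstUnmarked ms) ⟨
    Maybe.map (punchIn (suc p) ∘ suc) (firstUnmarked ms)
      ≡⟨ Maybe.map-∘ (firstUnmarked ms) ⟩
    Maybe.map (punchIn (suc p)) (Maybe.map suc (firstUnmarked ms))
      ≡⟨ cong (Maybe.map (punchIn (suc p))) (firstUnmarked-marked-∷ m-marked ms) ⟨
    Maybe.map (punchIn (suc p)) (firstUnmarked (m ∷ ms)) ∎
    where open ≡-Reasoning

  length-zip : (xs : List A) (ys : List B) → length xs ≡ length ys → length (zip xs ys) ≡ length ys
  length-zip []       []       _  = refl
  length-zip (x ∷ xs) (y ∷ ys) eq = cong suc (length-zip xs ys (suc-injective eq))

  argminUnmarked-via-argminGo : ∀ w ms → argminUnmarked w ms ≡ Maybe.map proj₁ (argminGo 0 (zip w ms) nothing)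
  argminUnmarked-via-argminGo w ms with argminGo 0 (zip w ms) nothing
  ... | nothing      = refl
  ... | just (i , _) = refl

  argminUnmarked-insertAt-marked : ∀ {mk} → Marked mk → ∀ p a w ms → length w ≡ length ms → p ≤ length ms →
    argminUnmarked (insertAt p a w) (insertAt p mk ms) ≡ Maybe.map (punchIn p) (argminUnmarked w ms)
  argminUnmarked-insertAt-marked {mk} mk-marked p a w ms eq h = begin
    argminUnmarked (insertAt p a w) (insertAt p mk ms)
      ≡⟨ argminUnmarked-via-argminGo (insertAt p a w) (insertAt p mk ms) ⟩
    Maybe.map proj₁ (argminGo 0 (zip (insertAt p a w) (insertAt p mk ms)) nothing)
      ≡⟨ cong (λ L → Maybe.map proj₁ (argminGo 0 L nothing)) (zip-insertAt p a mk w ms eq h) ⟩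
    Maybe.map proj₁ (argminGo 0 (insertAt p (a , mk) (zip w ms)) nothing)
      ≡⟨ cong (Maybe.map proj₁) (argminGo-insertAt-marked mk-marked a p 0 (zip w ms) nothing h′ tt) ⟩
    Maybe.map proj₁ (punchInBest p (argminGo 0 (zip w ms) nothing))
      ≡⟨ Maybe.map-∘ (argminGo 0 (zip w ms) nothing) ⟨
    Maybe.map (punchIn p ∘ proj₁) (argminGo 0 (zip w ms) nothing)
      ≡⟨ Maybe.map-∘ (argminGo 0 (zip w ms) nothing) ⟩
    Maybe.map (punchIn p) (Maybe.map proj₁ (argminGo 0 (zip w ms) nothing))
      ≡⟨ cong (Maybe.map (punchIn p)) (argminUnmarked-via-argminGo w ms) ⟨
    Maybe.map (punchIn p) (argminUnmarked w ms) ∎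
    where
    open ≡-Reasoning
    h′ : p ≤ length (zip w ms)
    h′ = subst (p ≤_) (sym (length-zip w ms eq)) h

  length-crossRound : ∀ w ms → length (crossRound w ms) ≡ length ms
  length-crossRound w ms = trans (length-setAt (firstUnmarked msB) mA msB) (length-setAt (argminUnmarked w ms) mB ms)
    where
    msB : List Mark
    msB = setAt (argminUnmarked w ms) mB ms

  length-iterRounds : ∀ f w ms → length (iterRounds f w ms) ≡ length ms
  length-iterRounds zero    w ms = refl
  length-iterRounds (suc f) w ms = trans (length-iterRounds f w (crossRound w ms)) (length-crossRound w ms)

  crossRound-insertAt-marked : ∀ {mk} → Marked mk → ∀ p a w ms → length w ≡ length ms → p ≤ length ms →
                               crossRound (insertAt p a w) (insertAt p mk ms) ≡ insertAt p mk (crossRound w ms)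
  crossRound-insertAt-marked {mk} mk-marked p a w ms eq h = begin
    setAt (firstUnmarked msB′) mA msB′
      ≡⟨ cong (λ z → setAt (firstUnmarked z) mA z) afterB ⟩
    setAt (firstUnmarked (insertAt p mk msB)) mA (insertAt p mk msB)
      ≡⟨ cong (λ i → setAt i mA (insertAt p mk msB)) (firstUnmarked-insertAt-marked mk-marked p msB hB) ⟩
    setAt (Maybe.map (punchIn p) (firstUnmarked msB)) mA (insertAt p mk msB)
      ≡⟨ setAt-punchIn p mA mk msB (firstUnmarked msB) hB ⟩
    insertAt p mk (setAt (firstUnmarked msB) mA msB) ∎
    where
    open ≡-Reasoning
    msB′ msB : List Mark
    msB′ = setAt (argminUnmarked (insertAt p a w) (insertAt p mk ms)) mB (insertAt p mk ms)
    msB  = setAt (argminUnmarked w ms) mB ms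
    hB : p ≤ length msB
    hB = subst (p ≤_) (sym (length-setAt (argminUnmarked w ms) mB ms)) h
    afterB : msB′ ≡ insertAt p mk msB
    afterB = trans (cong (λ i → setAt i mB (insertAt p mk ms))
                         (argminUnmarked-insertAt-marked mk-marked p a w ms eq h))
                   (setAt-punchIn p mB mk ms (argminUnmarked w ms) h)

  iterRounds-insertAt-marked : ∀ {mk} → Marked mk → ∀ f p a w ms → length w ≡ length ms → p ≤ length ms →
                               iterRounds f (insertAt p a w) (insertAt p mk ms) ≡ insertAt p mk (iterRounds f w ms)
  iterRounds-insertAt-marked mk zero    p a w ms eq h = refl
  iterRounds-insertAt-marked mk (suc f) p a w ms eq h =
    trans (cong (iterRounds f (insertAt p a w)) (crossRound-insertAt-marked mk p a w ms eq h))
          (iterRounds-insertAt-marked mk f p a w (crossRound w ms) (trans eq (sym (length-crossRound w ms)))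
                                     (subst (p ≤_) (sym (length-crossRound w ms)) h))

  noMarks : List ℕ → List Mark
  noMarks w = map (λ _ → unm) w

  length-noMarks : ∀ w → length (noMarks w) ≡ length w
  length-noMarks w = length-map (λ _ → unm) w

  zip-noMarks : ∀ w → zip w (noMarks w) ≡ unmarked w
  zip-noMarks []      = refl
  zip-noMarks (x ∷ w) = cong ((x , unm) ∷_) (zip-noMarks w)

  crossRound-insertAt-minimum : ∀ p m y v → All (m <_) (y ∷ v) → p ≤ suc (length v) →
    crossRound (insertAt p m (y ∷ v)) (noMarks (insertAt p m (y ∷ v))) ≡ insertAt p mB (mA ∷ noMarks v)
  crossRound-insertAt-minimum p m y v m<yv h = begin
    setAt (firstUnmarked msB′) mA msB′
      ≡⟨ cong (λ z → setAt (firstUnmarked z) mA z) afterB ⟩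
    setAt (firstUnmarked (insertAt p mB (unm ∷ noMarks v))) mA (insertAt p mB (unm ∷ noMarks v))
      ≡⟨ cong (λ i → setAt i mA (insertAt p mB (unm ∷ noMarks v)))
              (firstUnmarked-insertAt-marked markedB p _ h′) ⟩
    setAt (just (punchIn p 0)) mA (insertAt p mB (unm ∷ noMarks v))
      ≡⟨ setAt-punchIn p mA mB (unm ∷ noMarks v) (just 0) h′ ⟩
    insertAt p mB (mA ∷ noMarks v) ∎
    where
    open ≡-Reasoning
    w : List ℕ
    w    = insertAt p m (y ∷ v)
    msB′ : List Mark
    msB′ = setAt (argminUnmarked w (noMarks w)) mB (noMarks w)
    h′ : p ≤ length (unm ∷ noMarks v)
    h′ = subst (λ k → p ≤ suc k) (sym (length-noMarks v)) h
    noMarks-w : noMarks w ≡ insertAt p unm (noMarks (y ∷ v))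
    noMarks-w = map-insertAt (λ _ → unm) p m (y ∷ v)
    argmin-w : argminUnmarked w (noMarks w) ≡ just p
    argmin-w = begin
      argminUnmarked w (noMarks w)
        ≡⟨ argminUnmarked-via-argminGo w (noMarks w) ⟩
      Maybe.map proj₁ (argminGo 0 (zip w (noMarks w)) nothing)
        ≡⟨ cong (λ L → Maybe.map proj₁ (argminGo 0 L nothing)) (zip-noMarks w) ⟩
      Maybe.map proj₁ (argminGo 0 (unmarked w) nothing)
        ≡⟨ cong (λ L → Maybe.map proj₁ (argminGo 0 L nothing)) (map-insertAt (_, unm) p m (y ∷ v)) ⟩
      Maybe.map proj₁ (argminGo 0 (insertAt p (m , unm) (unmarked (y ∷ v))) nothing)
        ≡⟨ cong (Maybe.map proj₁) (argminGo-insertAt-minimum m p 0 (y ∷ v) nothing m<yv tt h) ⟩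
      just p ∎
    afterB : msB′ ≡ insertAt p mB (unm ∷ noMarks v)
    afterB = trans (cong₂ (λ i ms → setAt i mB ms) argmin-w noMarks-w)
                   (setAt-insertAt p mB unm (noMarks (y ∷ v)) h′)

  -- Marked entries are inert, so after the first round the crossout proceeds on v alone.
  iterRounds-insertAt-minimum : ∀ f p m y v → All (m <_) (y ∷ v) → p ≤ suc (length v) →
    iterRounds (suc f) (insertAt p m (y ∷ v)) (noMarks (insertAt p m (y ∷ v)))
    ≡ insertAt p mB (mA ∷ iterRounds f v (noMarks v))
  iterRounds-insertAt-minimum f p m y v m<yv h =
    trans (cong (iterRounds f (insertAt p m (y ∷ v))) (crossRound-insertAt-minimum p m y v m<yv h))
    (trans (iterRounds-insertAt-marked markedB f p m (y ∷ v) (mA ∷ noMarks v) (cong suc lenv)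
                                       (subst (λ k → p ≤ suc k) lenv h))
           (cong (insertAt p mB) (iterRounds-insertAt-marked markedA f 0 y v (noMarks v) lenv z≤n)))
    where
    lenv : length v ≡ length (noMarks v)
    lenv = sym (length-noMarks v)

  countᵇ : (A → Bool) → List A → ℕ
  countᵇ f xs = length (filterᵇ f xs)

  boolToℕ : Bool → ℕ
  boolToℕ true  = 1
  boolToℕ false = 0

  countᵇ-∷ : (f : A → Bool) (a : A) (xs : List A) →
             countᵇ f (a ∷ xs) ≡ boolToℕ (f a) ℕ.+ countᵇ f xs
  countᵇ-∷ f a xs with f a
  ... | true  = refl
  ... | false = refl

  countᵇ-none : (f : A → Bool) (xs : List A) → All (λ a → f a ≡ false) xs → countᵇ f xs ≡ 0
  countᵇ-none f []       []       = refl
  countᵇ-none f (a ∷ xs) (h ∷ hs) rewrite countᵇ-∷ f a xs | h = countᵇ-none f xs hs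

  countᵇ-all : (f : A → Bool) (xs : List A) → All (λ a → f a ≡ true) xs → countᵇ f xs ≡ length xs
  countᵇ-all f []       []       = refl
  countᵇ-all f (a ∷ xs) (h ∷ hs) rewrite countᵇ-∷ f a xs | h = cong suc (countᵇ-all f xs hs)

  countᵇ-cong : (f g : A → Bool) (xs : List A) → All (λ a → f a ≡ g a) xs →
                countᵇ f xs ≡ countᵇ g xs
  countᵇ-cong f g []       []       = refl
  countᵇ-cong f g (a ∷ xs) (h ∷ hs) rewrite countᵇ-∷ f a xs | countᵇ-∷ g a xs | h =
    cong (boolToℕ (g a) ℕ.+_) (countᵇ-cong f g xs hs)

  filterᵇ-insertAt-reject : (f : A → Bool) (p : ℕ) (x : A) (xs : List A) → f x ≡ false →
                            filterᵇ f (insertAt p x xs) ≡ filterᵇ f xs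
  filterᵇ-insertAt-reject f zero    x xs       h rewrite h = refl
  filterᵇ-insertAt-reject f (suc p) x []       h rewrite h = refl
  filterᵇ-insertAt-reject f (suc p) x (a ∷ xs) h with f a
  ... | true  = cong (a ∷_) (filterᵇ-insertAt-reject f p x xs h)
  ... | false = filterᵇ-insertAt-reject f p x xs h

  countᵇ-insertAt-reject : (f : A → Bool) (p : ℕ) (x : A) (xs : List A) → f x ≡ false →
                           countᵇ f (insertAt p x xs) ≡ countᵇ f xs
  countᵇ-insertAt-reject f p x xs h = cong length (filterᵇ-insertAt-reject f p x xs h)

  countPairs-insertAt-unrelated : (P : A → A → Bool) (p : ℕ) (x : A) (xs : List A) →
    (∀ a → P a x ≡ false) → (∀ b → P x b ≡ false) → countPairs P (insertAt p x xs) ≡ countPairs P xs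
  countPairs-insertAt-unrelated P zero    x xs       h₁ h₂ =
    cong (ℕ._+ countPairs P xs) (countᵇ-none (P x) xs (All.universal h₂ xs))
  countPairs-insertAt-unrelated P (suc p) x []       h₁ h₂ = refl
  countPairs-insertAt-unrelated P (suc p) x (a ∷ xs) h₁ h₂ =
    cong₂ ℕ._+_ (countᵇ-insertAt-reject (P a) p x xs (h₁ a)) (countPairs-insertAt-unrelated P p x xs h₁ h₂)

  countPairs-insertAt-least : (P : A → A → Bool) (p : ℕ) (x : A) (xs : List A) →
    All (λ a → P a x ≡ false) xs → All (λ b → P x b ≡ true) xs → p ≤ length xs →
    countPairs P (insertAt p x xs) ≡ (length xs ∸ p) ℕ.+ countPairs P xs
  countPairs-insertAt-least P zero x xs h₁ h₂ _ = cong (ℕ._+ countPairs P xs) (countᵇ-all (P x) xs h₂)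
  countPairs-insertAt-least P (suc p) x (a ∷ xs) (h₁ ∷ h₁s) (h₂ ∷ h₂s) (s≤s hp) = begin
    countᵇ (P a) (insertAt p x xs) ℕ.+ countPairs P (insertAt p x xs)
      ≡⟨ cong₂ ℕ._+_ (countᵇ-insertAt-reject (P a) p x xs h₁)
                     (countPairs-insertAt-least P p x xs h₁s h₂s hp) ⟩
    countᵇ (P a) xs ℕ.+ ((length xs ∸ p) ℕ.+ countPairs P xs)
      ≡⟨ m+[n+o]≡n+[m+o] (countᵇ (P a) xs) (length xs ∸ p) (countPairs P xs) ⟩
    (length xs ∸ p) ℕ.+ (countᵇ (P a) xs ℕ.+ countPairs P xs) ∎
    where open ≡-Reasoning

  aaOf : List (ℕ × Mark) → ℕ
  aaOf = countPairs (λ x y → isA (proj₂ x) ∧ isA (proj₂ y) ∧ (proj₁ y <ᵇ proj₁ x))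

  zOf : List (ℕ × Mark) → ℕ
  zOf = countPairs (λ x y → isB (proj₂ x) ∧ (proj₁ x <ᵇ proj₁ y))

  aValues : List (ℕ × Mark) → List ℕ
  aValues L = map proj₁ (filterᵇ (λ x → isA (proj₂ x)) L)

  aBelow : ℕ → List (ℕ × Mark) → ℕ
  aBelow y = countᵇ (λ x → isA (proj₂ x) ∧ (proj₁ x <ᵇ y))

  aaOf-insertAt-pair : ∀ p m y L → aaOf (insertAt p (m , mB) ((y , mA) ∷ L)) ≡ aBelow y L ℕ.+ aaOf L
  aaOf-insertAt-pair p m y L =
    countPairs-insertAt-unrelated _ p (m , mB) ((y , mA) ∷ L) (λ a → ∧-zeroʳ (isA (proj₂ a))) (λ b → refl)

  zOf-insertAt-pair : ∀ p m y L → m < y → All (λ x → m < proj₁ x) L → p ≤ suc (length L) →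
                      zOf (insertAt p (m , mB) ((y , mA) ∷ L)) ≡ (suc (length L) ∸ p) ℕ.+ zOf L
  zOf-insertAt-pair p m y L m<y m<L hp =
    trans (countPairs-insertAt-least _ p (m , mB) ((y , mA) ∷ L) (notBefore {k = mA} m<y ∷ All.map notBefore m<L)
                                     (<ᵇ-true m<y ∷ All.map <ᵇ-true m<L) hp)
          (cong (λ k → (suc (length L) ∸ p) ℕ.+ (k ℕ.+ zOf L))
                (countᵇ-none _ L (All.universal (λ _ → refl) L)))
    where
    notBefore : ∀ {x k} → m < x → (isB k ∧ (x <ᵇ m)) ≡ false
    notBefore {k = k} m<x rewrite <ᵇ-false m<x = ∧-zeroʳ (isB k)

  aValues-insertAt-pair : ∀ p m y L → aValues (insertAt p (m , mB) ((y , mA) ∷ L)) ≡ y ∷ aValues L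
  aValues-insertAt-pair p m y L = cong (map proj₁) (filterᵇ-insertAt-reject _ p (m , mB) ((y , mA) ∷ L) refl)

  aBelow-aValues : ∀ y L → aBelow y L ≡ countᵇ (_<ᵇ y) (aValues L)
  aBelow-aValues y []              = refl
  aBelow-aValues y ((v , unm) ∷ L) = aBelow-aValues y L
  aBelow-aValues y ((v , mB) ∷ L)  = aBelow-aValues y L
  aBelow-aValues y ((v , mA) ∷ L)
    rewrite countᵇ-∷ (λ x → isA (proj₂ x) ∧ (proj₁ x <ᵇ y)) (v , mA) L | countᵇ-∷ (_<ᵇ y) v (aValues L) =
    cong (boolToℕ (v <ᵇ y) ℕ.+_) (aBelow-aValues y L)

  All-aValues : ∀ {Q : ℕ → Set} v ms → All Q v → All Q (aValues (zip v ms))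
  All-aValues []      ms         _        = []
  All-aValues (x ∷ v) []         _        = []
  All-aValues (x ∷ v) (unm ∷ ms) (_ ∷ qs) = All-aValues v ms qs
  All-aValues (x ∷ v) (mB ∷ ms)  (_ ∷ qs) = All-aValues v ms qs
  All-aValues (x ∷ v) (mA ∷ ms)  (q ∷ qs) = q ∷ All-aValues v ms qs

  aValues-unique : ∀ v ms → Unique v → Unique (aValues (zip v ms))
  aValues-unique []      ms         _          = []
  aValues-unique (x ∷ v) []         _          = []
  aValues-unique (x ∷ v) (unm ∷ ms) (_ ∷ uv)   = aValues-unique v ms uv
  aValues-unique (x ∷ v) (mB ∷ ms)  (_ ∷ uv)   = aValues-unique v ms uv
  aValues-unique (x ∷ v) (mA ∷ ms)  (x∉v ∷ uv) = All-aValues v ms x∉v ∷ aValues-unique v ms uv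

  All-zip : ∀ {Q : ℕ → Set} v (ms : List Mark) → All Q v → All (λ x → Q (proj₁ x)) (zip v ms)
  All-zip []      ms       _        = []
  All-zip (x ∷ v) []       _        = []
  All-zip (x ∷ v) (_ ∷ ms) (q ∷ qs) = q ∷ All-zip v ms qs

  length-rounds : ∀ f v → length (iterRounds f v (noMarks v)) ≡ length v
  length-rounds f v = trans (length-iterRounds f v (noMarks v)) (length-noMarks v)

  -- marked w = markedAfter (length w) w, so aa w = aaOf (marked w) and zstat w = zOf (marked w).
  markedAfter : ℕ → List ℕ → List (ℕ × Mark)
  markedAfter f w = zip w (iterRounds f w (noMarks w))

  length-markedAfter : ∀ f v → length (markedAfter f v) ≡ length v
  length-markedAfter f v = trans (length-zip v _ (sym (length-rounds f v))) (length-rounds f v)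

  markedAfter-insertAt-minimum : ∀ f p m y v → m < y → All (m <_) v → p ≤ suc (length v) →
    markedAfter (suc f) (insertAt p m (y ∷ v)) ≡ insertAt p (m , mB) ((y , mA) ∷ markedAfter f v)
  markedAfter-insertAt-minimum f p m y v m<y m<v hp =
    trans (cong (zip (insertAt p m (y ∷ v))) (iterRounds-insertAt-minimum f p m y v (m<y ∷ m<v) hp))
          (zip-insertAt p m mB (y ∷ v) (mA ∷ iterRounds f v (noMarks v)) (cong suc (sym (length-rounds f v)))
                        (subst (λ k → p ≤ suc k) (sym (length-rounds f v)) hp))

  infix 4 _∈ᵇ_

  _∈ᵇ_ : ℕ → List ℕ → Bool
  k ∈ᵇ A = any (λ v → k ≡ᵇ v) A

  -- pathA w = pathOn (range1 (length w)) (aValues (marked w)).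
  pathOn : List ℕ → List ℕ → List Bool
  pathOn S A = map (λ k → not (k ∈ᵇ A)) S

  ∈ᵇ≡does-∈? : ∀ k A → (k ∈ᵇ A) ≡ does (k ∈? A)
  ∈ᵇ≡does-∈? k []      = refl
  ∈ᵇ≡does-∈? k (v ∷ A) = cong ((k ≡ᵇ v) ∨_) (∈ᵇ≡does-∈? k A)

  ∈⇒∈ᵇ : ∀ {k A} → k ∈ A → (k ∈ᵇ A) ≡ true
  ∈⇒∈ᵇ {k} {A} k∈A = trans (∈ᵇ≡does-∈? k A) (dec-true (k ∈? A) k∈A)

  ∉⇒∈ᵇ-false : ∀ {k A} → ¬ k ∈ A → (k ∈ᵇ A) ≡ false
  ∉⇒∈ᵇ-false {k} {A} k∉A = trans (∈ᵇ≡does-∈? k A) (dec-false (k ∈? A) k∉A)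

  length-pathOn : ∀ S A → length (pathOn S A) ≡ length S
  length-pathOn S A = length-map _ S

  pathOn-++ : ∀ P Q A → pathOn (P ++ Q) A ≡ pathOn P A ++ pathOn Q A
  pathOn-++ P Q A = map-++ _ P Q

  pathOn-skip : ∀ y A P → All (λ k → ¬ k ≡ y) P → pathOn P (y ∷ A) ≡ pathOn P A
  pathOn-skip y A P k≢y =
    map-cong-local (All.map (λ {k} h → cong (λ b → not (b ∨ (k ∈ᵇ A))) (≢⇒≡ᵇ-false h)) k≢y)

  pathOn-least : ∀ s S y A → s < y → All (s <_) A → pathOn (s ∷ S) (y ∷ A) ≡ true ∷ pathOn S (y ∷ A)
  pathOn-least s S y A s<y s<A = cong (λ b → not b ∷ pathOn S (y ∷ A)) (∉⇒∈ᵇ-false s∉yA)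
    where
    s∉yA : ¬ s ∈ y ∷ A
    s∉yA s∈yA = <-irrefl refl (All.lookup (s<y ∷ s<A) s∈yA)

  pathOn-split : ∀ P y Q A → All (_< y) P → All (y <_) Q →
                 pathOn (P ++ y ∷ Q) (y ∷ A) ≡ pathOn P A ++ false ∷ pathOn Q A
  pathOn-split P y Q A P<y y<Q =
    trans (pathOn-++ P (y ∷ Q) (y ∷ A))
          (cong₂ _++_ (pathOn-skip y A P (All.map <⇒≢ P<y))
                      (cong₂ _∷_ (cong (λ b → not (b ∨ (y ∈ᵇ A))) (≡ᵇ-refl y))
                                 (pathOn-skip y A Q (All.map (≢-sym ∘ <⇒≢) y<Q))))

  downSteps : List Bool → ℕ
  downSteps = countᵇ not

  countᵇ-map : (f : B → Bool) (g : A → B) (xs : List A) → countᵇ f (map g xs) ≡ countᵇ (f ∘ g) xs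
  countᵇ-map f g []       = refl
  countᵇ-map f g (x ∷ xs) rewrite countᵇ-∷ f (g x) (map g xs) | countᵇ-∷ (f ∘ g) x xs =
    cong (boolToℕ (f (g x)) ℕ.+_) (countᵇ-map f g xs)

  downSteps-pathOn : ∀ P A → downSteps (pathOn P A) ≡ countᵇ (_∈ᵇ A) P
  downSteps-pathOn P A =
    trans (countᵇ-map not _ P) (countᵇ-cong _ _ P (All.universal (λ k → not-involutive (k ∈ᵇ A)) P))

  countᵇ-∈ᵇ-∷ : ∀ x P A → Unique A → ¬ x ∈ P →
    countᵇ (_∈ᵇ x ∷ P) A ≡ boolToℕ (x ∈ᵇ A) ℕ.+ countᵇ (_∈ᵇ P) A
  countᵇ-∈ᵇ-∷ x P []      _          _   = refl
  countᵇ-∈ᵇ-∷ x P (a ∷ A) (a∉A ∷ uA) x∉P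
    rewrite countᵇ-∷ (_∈ᵇ x ∷ P) a A | countᵇ-∷ (_∈ᵇ P) a A with a ≟ x
  ... | yes refl rewrite ≡ᵇ-refl a | ∉⇒∈ᵇ-false x∉P =
    cong suc (countᵇ-cong _ _ A (All.map (λ {b} a≢b → cong (_∨ (b ∈ᵇ P)) (≢⇒≡ᵇ-false (≢-sym a≢b))) a∉A))
  ... | no a≢x rewrite ≢⇒≡ᵇ-false a≢x | ≢⇒≡ᵇ-false (≢-sym a≢x) =
    trans (cong (boolToℕ (a ∈ᵇ P) ℕ.+_) (countᵇ-∈ᵇ-∷ x P A uA x∉P))
          (m+[n+o]≡n+[m+o] (boolToℕ (a ∈ᵇ P)) (boolToℕ (x ∈ᵇ A)) _)

  countᵇ-∈ᵇ-comm : ∀ P A → Unique P → Unique A → countᵇ (_∈ᵇ A) P ≡ countᵇ (_∈ᵇ P) A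
  countᵇ-∈ᵇ-comm []      A _          _  = sym (countᵇ-none _ A (All.universal (λ _ → refl) A))
  countᵇ-∈ᵇ-comm (x ∷ P) A (x∉P ∷ uP) uA rewrite countᵇ-∷ (_∈ᵇ A) x P =
    trans (cong (boolToℕ (x ∈ᵇ A) ℕ.+_) (countᵇ-∈ᵇ-comm P A uP uA))
          (sym (countᵇ-∈ᵇ-∷ x P A uA (All¬⇒¬Any x∉P)))

  downSteps-pathOn-prefix : ∀ P y Q A → All (_< y) P → All (y <_) Q → Unique P → Unique A →
                            All (_∈ P ++ Q) A →
                            downSteps (pathOn P A) ≡ countᵇ (_<ᵇ y) A
  downSteps-pathOn-prefix P y Q A P<y y<Q uP uA A⊆PQ =
    trans (downSteps-pathOn P A) (trans (countᵇ-∈ᵇ-comm P A uP uA) (countᵇ-cong _ _ A (All.map inP⇔below A⊆PQ)))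
    where
    inP⇔below : ∀ {a} → a ∈ P ++ Q → (a ∈ᵇ P) ≡ (a <ᵇ y)
    inP⇔below {a} a∈PQ with ∈-++⁻ P a∈PQ
    ... | inj₁ a∈P = trans (∈⇒∈ᵇ a∈P) (sym (<ᵇ-true (All.lookup P<y a∈P)))
    ... | inj₂ a∈Q = trans (∉⇒∈ᵇ-false (λ a∈P → <-asym (All.lookup P<y a∈P) (All.lookup y<Q a∈Q)))
                           (sym (<ᵇ-false (All.lookup y<Q a∈Q)))

  length-++-∷ : (xs : List A) {y : A} {ys : List A} {k : ℕ} →
                length (xs ++ y ∷ ys) ≡ suc k → length (xs ++ ys) ≡ k
  length-++-∷ xs {y} {ys} len = suc-injective (trans (sym (length-++-sucʳ xs y ys)) len)

  ++-cancel-≡length : (xs ys : List A) {zs ws : List A} → length xs ≡ length ys →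
                      xs ++ zs ≡ ys ++ ws → xs ≡ ys × zs ≡ ws
  ++-cancel-≡length []       []       _  eq = refl , eq
  ++-cancel-≡length (x ∷ xs) (y ∷ ys) ln eq with ∷-injective eq
  ... | refl , eq′ with ++-cancel-≡length xs ys (suc-injective ln) eq′
  ...   | refl , refl = refl , refl

  remove : ℕ → List ℕ → List ℕ
  remove x = filterᵇ (λ y → not (x ≡ᵇ y))

  remove-∷-≢ : ∀ {m s} S → ¬ m ≡ s → remove m (s ∷ S) ≡ s ∷ remove m S
  remove-∷-≢ S m≢s rewrite ≢⇒≡ᵇ-false m≢s = refl

  remove-∷-≡ : ∀ s S → remove s (s ∷ S) ≡ remove s S
  remove-∷-≡ s S rewrite ≡ᵇ-refl s = refl

  remove-∉ : ∀ {x} S → All (λ y → ¬ x ≡ y) S → remove x S ≡ S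
  remove-∉ []      []          = refl
  remove-∉ (y ∷ S) (x≢y ∷ x∉S) = trans (remove-∷-≢ S x≢y) (cong (y ∷_) (remove-∉ S x∉S))

  remove-head : ∀ s S → All (λ y → ¬ s ≡ y) S → remove s (s ∷ S) ≡ S
  remove-head s S s∉S = trans (remove-∷-≡ s S) (remove-∉ S s∉S)

  length-remove : ∀ {m} S → Unique S → m ∈ S → suc (length (remove m S)) ≡ length S
  length-remove (s ∷ S) (s∉S ∷ _)  (here refl) = cong suc (cong length (remove-head s S s∉S))
  length-remove (s ∷ S) (s∉S ∷ uS) (there m∈S) rewrite remove-∷-≢ S (≢-sym (All.lookup s∉S m∈S)) =
    cong suc (length-remove S uS m∈S)

  remove-comm : ∀ a b S → remove a (remove b S) ≡ remove b (remove a S)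
  remove-comm a b []      = refl
  remove-comm a b (s ∷ S) with a ≡ᵇ s in ea | b ≡ᵇ s in eb
  ... | true  | true                  = remove-comm a b S
  ... | true  | false rewrite ea      = remove-comm a b S
  ... | false | true  rewrite eb      = remove-comm a b S
  ... | false | false rewrite ea | eb = cong (s ∷_) (remove-comm a b S)

  ∈-remove⁻ : ∀ {x m S} → x ∈ remove m S → x ∈ S × ¬ m ≡ x
  ∈-remove⁻ {x} {m} {S} x∈ with ∈-filter⁻ (λ y → T? (not (m ≡ᵇ y))) {xs = S} x∈
  ... | x∈S , keep = x∈S , λ { refl → subst (T ∘ not) (≡ᵇ-refl m) keep }

  ∈-remove⁺ : ∀ {x m S} → x ∈ S → ¬ m ≡ x → x ∈ remove m S
  ∈-remove⁺ {x} {m} x∈S m≢x =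
    ∈-filter⁺ (λ y → T? (not (m ≡ᵇ y))) x∈S (subst (T ∘ not) (sym (≢⇒≡ᵇ-false m≢x)) tt)

  remove-unique : ∀ m S → Unique S → Unique (remove m S)
  remove-unique m S = Unique.filter⁺ (λ y → T? (not (m ≡ᵇ y)))

  record Split (A : Set) : Set where
    constructor split
    field
      before : List A
      pivot  : A
      after  : List A

    joined : List A
    joined = before ++ after

  open Split public

  splits : List A → List (Split A)
  splits []       = []
  splits (x ∷ xs) = split [] x xs ∷ map (consBefore x) (splits xs)
    where
    consBefore : A → Split A → Split A
    consBefore x s = split (x ∷ before s) (pivot s) (after s)

  Sorted : List ℕ → Set
  Sorted = AllPairs _<_

  Sorted⇒Unique : ∀ {S} → Sorted S → Unique S
  Sorted⇒Unique = AllPairs.map (λ x<y x≡y → <-irrefl x≡y x<y)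

  Sorted-range1 : ∀ m → Sorted (range1 m)
  Sorted-range1 m = subst Sorted (sym (map-upTo suc m)) (AllPairs.applyUpTo⁺₁ suc m (λ i<j _ → s≤s i<j))

  length-range1 : ∀ m → length (range1 m) ≡ m
  length-range1 m = trans (length-map suc (upTo m)) (length-upTo m)

  Sorted-++⁻ˡ : ∀ P {X} → Sorted (P ++ X) → Sorted P
  Sorted-++⁻ˡ []      _                     = AllPairs.[]
  Sorted-++⁻ˡ (x ∷ P) (x<PX AllPairs.∷ sPX) = ++⁻ˡ P x<PX AllPairs.∷ Sorted-++⁻ˡ P sPX

  Sorted-split : ∀ P y Q → Sorted (P ++ y ∷ Q) → All (_< y) P × All (y <_) Q × Sorted (P ++ Q)
  Sorted-split []      y Q (y<Q AllPairs.∷ sQ)     = [] , y<Q , sQ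
  Sorted-split (x ∷ P) y Q (x<PyQ AllPairs.∷ sPyQ) with Sorted-split P y Q sPyQ | ++⁻ʳ P x<PyQ
  ... | P<y , y<Q , sPQ | x<y ∷ x<Q = x<y ∷ P<y , y<Q , ++⁺ (++⁻ˡ P x<PyQ) x<Q AllPairs.∷ sPQ

open Combinatorics

module Sums {c ℓ} (R : CommutativeSemiring c ℓ) where

  open CommutativeSemiring R
  open import Relation.Binary.Reasoning.Setoid setoid
  open import Data.List.Relation.Unary.Unique.DecPropositional ℕ._≟_ using (unique?)
  open import Algebra.Properties.CommutativeSemigroup +-commutativeSemigroup
    using () renaming (interchange to +-interchange; x∙yz≈y∙xz to +-leftSwap)

  private variable A B : Set

  ∑ : List A → (A → Carrier) → Carrier
  ∑ xs f = sumR R (map f xs)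

  syntax ∑ xs (λ x → e) = ∑[ x ∈ xs ] e

  iverson : Bool → Carrier → Carrier
  iverson b x = if b then x else 0#

  ∑-cong-∈ : (xs : List A) {f g : A → Carrier} → (∀ x → x ∈ xs → f x ≈ g x) → ∑ xs f ≈ ∑ xs g
  ∑-cong-∈ []       h = refl
  ∑-cong-∈ (x ∷ xs) h = +-cong (h x (here ≡.refl)) (∑-cong-∈ xs (λ y y∈ → h y (there y∈)))

  ∑-cong : (xs : List A) {f g : A → Carrier} → (∀ x → f x ≈ g x) → ∑ xs f ≈ ∑ xs g
  ∑-cong xs h = ∑-cong-∈ xs (λ x _ → h x)

  ∑-map : (g : A → B) (xs : List A) (f : B → Carrier) → ∑ (map g xs) f ≡ ∑ xs (f ∘ g)
  ∑-map g []       f = ≡.refl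
  ∑-map g (x ∷ xs) f = ≡.cong (f (g x) +_) (∑-map g xs f)

  ∑-0 : (xs : List A) → ∑ xs (λ _ → 0#) ≈ 0#
  ∑-0 []       = refl
  ∑-0 (x ∷ xs) = trans (+-identityˡ _) (∑-0 xs)

  ∑-++ : (xs ys : List A) (f : A → Carrier) → ∑ (xs ++ ys) f ≈ ∑ xs f + ∑ ys f
  ∑-++ []       ys f = sym (+-identityˡ _)
  ∑-++ (x ∷ xs) ys f = trans (+-cong refl (∑-++ xs ys f)) (sym (+-assoc _ _ _))

  ∑-concatMap : (g : A → List B) (xs : List A) (f : B → Carrier) →
                ∑ (concatMap g xs) f ≈ ∑[ x ∈ xs ] ∑ (g x) f
  ∑-concatMap g []       f = refl
  ∑-concatMap g (x ∷ xs) f = trans (∑-++ (g x) (concatMap g xs) f) (+-cong refl (∑-concatMap g xs f))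

  ∑-+ : (xs : List A) (f g : A → Carrier) → ∑[ x ∈ xs ] (f x + g x) ≈ ∑ xs f + ∑ xs g
  ∑-+ []       f g = sym (+-identityˡ _)
  ∑-+ (x ∷ xs) f g = trans (+-cong refl (∑-+ xs f g)) (+-interchange _ _ _ _)

  ∑-*ˡ : (xs : List A) (a : Carrier) (f : A → Carrier) → ∑[ x ∈ xs ] (a * f x) ≈ a * ∑ xs f
  ∑-*ˡ []       a f = sym (zeroʳ a)
  ∑-*ˡ (x ∷ xs) a f = trans (+-cong refl (∑-*ˡ xs a f)) (sym (distribˡ a _ _))

  ∑-*ʳ : (xs : List A) (f : A → Carrier) (a : Carrier) → ∑[ x ∈ xs ] (f x * a) ≈ ∑ xs f * a
  ∑-*ʳ xs f a = trans (∑-cong xs (λ _ → *-comm _ _)) (trans (∑-*ˡ xs a f) (*-comm _ _))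

  ∑-swap : (xs : List A) (ys : List B) (f : A → B → Carrier) →
           ∑[ x ∈ xs ] ∑[ y ∈ ys ] f x y ≈ ∑[ y ∈ ys ] ∑[ x ∈ xs ] f x y
  ∑-swap []       ys f = sym (∑-0 ys)
  ∑-swap (x ∷ xs) ys f = trans (+-cong refl (∑-swap xs ys f)) (sym (∑-+ ys (f x) (λ y → ∑[ x ∈ xs ] f x y)))

  ∑-filterᵇ : (p : A → Bool) (xs : List A) (f : A → Carrier) →
              ∑ (filterᵇ p xs) f ≈ ∑[ x ∈ xs ] iverson (p x) (f x)
  ∑-filterᵇ p []       f = refl
  ∑-filterᵇ p (x ∷ xs) f with p x
  ... | true  = +-cong refl (∑-filterᵇ p xs f)
  ... | false = trans (∑-filterᵇ p xs f) (sym (+-identityˡ _))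

  ∑-filter : {P : A → Set} (P? : ∀ x → Dec (P x)) (xs : List A) (f : A → Carrier) →
             ∑ (filter P? xs) f ≈ ∑[ x ∈ xs ] iverson (does (P? x)) (f x)
  ∑-filter P? []       f = refl
  ∑-filter P? (x ∷ xs) f with does (P? x)
  ... | true  = +-cong refl (∑-filter P? xs f)
  ... | false = trans (∑-filter P? xs f) (sym (+-identityˡ _))

  iverson-∧ : ∀ a b x → iverson (a ∧ b) x ≡ iverson a (iverson b x)
  iverson-∧ true  b x = ≡.refl
  iverson-∧ false b x = ≡.refl

  iverson-*ˡ : ∀ b a x → iverson b (a * x) ≈ a * iverson b x
  iverson-*ˡ true  a x = refl
  iverson-*ˡ false a x = sym (zeroʳ a)

  iverson-cong : ∀ b {x y} → (b ≡ true → x ≈ y) → iverson b x ≈ iverson b y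
  iverson-cong true  h = h ≡.refl
  iverson-cong false h = refl

  iverson-0# : ∀ b → iverson b 0# ≈ 0#
  iverson-0# true  = refl
  iverson-0# false = refl

  ∑-iverson : (xs : List A) (b : Bool) (f : A → Carrier) → ∑[ x ∈ xs ] iverson b (f x) ≈ iverson b (∑ xs f)
  ∑-iverson xs true  f = refl
  ∑-iverson xs false f = ∑-0 xs

  ∑-upTo-suc : ∀ n (g : ℕ → Carrier) → ∑ (upTo (suc n)) g ≈ g 0 + ∑[ p ∈ upTo n ] g (suc p)
  ∑-upTo-suc n g =
    +-cong refl (reflexive (≡.trans (≡.cong (λ ps → ∑ ps g) (≡.sym (map-upTo suc n))) (∑-map suc (upTo n) g)))

  ∑-remove : ∀ S m (F : ℕ → Carrier) → Unique S → m ∈ S → ∑ S F ≈ F m + ∑ (remove m S) F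
  ∑-remove (s ∷ S) .s F (s∉S ∷ _) (here ≡.refl) rewrite remove-head s S s∉S = refl
  ∑-remove (s ∷ S) m F (s∉S ∷ uS) (there m∈S) rewrite remove-∷-≢ S (≡.≢-sym (All.lookup s∉S m∈S)) =
    trans (+-cong refl (∑-remove S m F uS m∈S)) (+-leftSwap (F s) (F m) _)

  avoids : ℕ → List ℕ → Bool
  avoids x w = does (All.all? (λ y → ¬? (x ℕ.≟ y)) w)

  ∑Perm : ℕ → List ℕ → (List ℕ → Carrier) → Carrier
  ∑Perm k S G = ∑ (filter unique? (words k S)) G

  ∑-words-suc : ∀ k S F → ∑ (words (suc k) S) F ≈ ∑[ x ∈ S ] ∑[ w ∈ words k S ] F (x ∷ w)
  ∑-words-suc k S F = trans (∑-concatMap (λ x → map (x ∷_) (words k S)) S F)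
                            (∑-cong S (λ x → reflexive (∑-map (x ∷_) (words k S) F)))

  ∑-words-avoiding : ∀ x k S H → ∑[ w ∈ words k S ] iverson (avoids x w) (H w) ≈ ∑ (words k (remove x S)) H
  ∑-words-avoiding x zero    S H = refl
  ∑-words-avoiding x (suc k) S H = begin
    ∑[ w ∈ words (suc k) S ] iverson (avoids x w) (H w)
      ≈⟨ ∑-words-suc k S _ ⟩
    ∑[ y ∈ S ] ∑[ w ∈ words k S ] iverson (not (x ≡ᵇ y) ∧ avoids x w) (H (y ∷ w))
      ≈⟨ ∑-cong S (λ y → ∑-cong (words k S) (λ w → reflexive (iverson-∧ (not (x ≡ᵇ y)) (avoids x w) _))) ⟩
    ∑[ y ∈ S ] ∑[ w ∈ words k S ] iverson (not (x ≡ᵇ y)) (iverson (avoids x w) (H (y ∷ w)))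
      ≈⟨ ∑-cong S (λ y → ∑-iverson (words k S) (not (x ≡ᵇ y)) _) ⟩
    ∑[ y ∈ S ] iverson (not (x ≡ᵇ y)) (∑[ w ∈ words k S ] iverson (avoids x w) (H (y ∷ w)))
      ≈⟨ ∑-cong S (λ y → iverson-cong (not (x ≡ᵇ y)) (λ _ → ∑-words-avoiding x k S (H ∘ (y ∷_)))) ⟩
    ∑[ y ∈ S ] iverson (not (x ≡ᵇ y)) (∑[ w ∈ words k (remove x S) ] H (y ∷ w))
      ≈⟨ ∑-filterᵇ (λ y → not (x ≡ᵇ y)) S _ ⟨
    ∑[ y ∈ remove x S ] ∑[ w ∈ words k (remove x S) ] H (y ∷ w)
      ≈⟨ ∑-words-suc k (remove x S) H ⟨
    ∑ (words (suc k) (remove x S)) H ∎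

  ∑Perm-suc : ∀ k S G → ∑Perm (suc k) S G ≈ ∑[ x ∈ S ] ∑Perm k (remove x S) (G ∘ (x ∷_))
  ∑Perm-suc k S G = begin
    ∑Perm (suc k) S G
      ≈⟨ ∑-filter unique? (words (suc k) S) G ⟩
    ∑[ w ∈ words (suc k) S ] iverson (does (unique? w)) (G w)
      ≈⟨ ∑-words-suc k S _ ⟩
    ∑[ x ∈ S ] ∑[ w ∈ words k S ] iverson (avoids x w ∧ does (unique? w)) (G (x ∷ w))
      ≈⟨ ∑-cong S (λ x → ∑-cong (words k S) (λ w → reflexive (iverson-∧ (avoids x w) (does (unique? w)) _))) ⟩
    ∑[ x ∈ S ] ∑[ w ∈ words k S ] iverson (avoids x w) (iverson (does (unique? w)) (G (x ∷ w)))
      ≈⟨ ∑-cong S (λ x → ∑-words-avoiding x k S (λ w → iverson (does (unique? w)) (G (x ∷ w)))) ⟩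
    ∑[ x ∈ S ] ∑[ w ∈ words k (remove x S) ] iverson (does (unique? w)) (G (x ∷ w))
      ≈⟨ ∑-cong S (λ x → ∑-filter unique? (words k (remove x S)) (G ∘ (x ∷_))) ⟨
    ∑[ x ∈ S ] ∑Perm k (remove x S) (G ∘ (x ∷_)) ∎

  -- Induction on k: either m is the first letter, or m sits in the word after the first letter.
  ∑Perm-insertAt : ∀ k S m G → Unique S → m ∈ S → length S ≡ suc k →
                   ∑Perm (suc k) S G ≈ ∑[ p ∈ upTo (suc k) ] ∑Perm k (remove m S) (G ∘ insertAt p m)
  ∑Perm-insertAt k S m G uS m∈S len = begin
    ∑Perm (suc k) S G
      ≈⟨ ∑Perm-suc k S G ⟩
    ∑[ x ∈ S ] ∑Perm k (remove x S) (G ∘ (x ∷_))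
      ≈⟨ ∑-remove S m _ uS m∈S ⟩
    ∑Perm k (remove m S) (G ∘ (m ∷_)) + ∑[ x ∈ remove m S ] ∑Perm k (remove x S) (G ∘ (x ∷_))
      ≈⟨ +-cong refl (otherHeads k len) ⟩
    ∑Perm k (remove m S) (G ∘ (m ∷_)) + ∑[ p ∈ upTo k ] ∑Perm k (remove m S) (G ∘ insertAt (suc p) m)
      ≈⟨ ∑-upTo-suc k (λ p → ∑Perm k (remove m S) (G ∘ insertAt p m)) ⟨
    ∑[ p ∈ upTo (suc k) ] ∑Perm k (remove m S) (G ∘ insertAt p m) ∎
    where
    otherHeads : ∀ k′ → length S ≡ suc k′ →
                 ∑[ x ∈ remove m S ] ∑Perm k′ (remove x S) (G ∘ (x ∷_))
                 ≈ ∑[ p ∈ upTo k′ ] ∑Perm k′ (remove m S) (G ∘ insertAt (suc p) m)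
    otherHeads zero len′ with remove m S | ℕ.suc-injective (≡.trans (length-remove S uS m∈S) len′)
    ... | [] | _ = refl
    otherHeads (suc k′) len′ = begin
      ∑[ x ∈ remove m S ] ∑Perm (suc k′) (remove x S) (G ∘ (x ∷_))
        ≈⟨ ∑-cong-∈ (remove m S) (λ x x∈ → insertUnderHead (∈-remove⁻ x∈)) ⟩
      ∑[ x ∈ remove m S ] ∑[ p ∈ upTo (suc k′) ]
        ∑Perm k′ (remove x (remove m S)) (G ∘ insertAt (suc p) m ∘ (x ∷_))
        ≈⟨ ∑-swap (remove m S) (upTo (suc k′)) _ ⟩
      ∑[ p ∈ upTo (suc k′) ] ∑[ x ∈ remove m S ]
        ∑Perm k′ (remove x (remove m S)) (G ∘ insertAt (suc p) m ∘ (x ∷_))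
        ≈⟨ ∑-cong (upTo (suc k′)) (λ p → ∑Perm-suc k′ (remove m S) (G ∘ insertAt (suc p) m)) ⟨
      ∑[ p ∈ upTo (suc k′) ] ∑Perm (suc k′) (remove m S) (G ∘ insertAt (suc p) m) ∎
      where
      insertUnderHead : ∀ {x} → x ∈ S × ¬ m ≡ x →
        ∑Perm (suc k′) (remove x S) (G ∘ (x ∷_))
        ≈ ∑[ p ∈ upTo (suc k′) ] ∑Perm k′ (remove x (remove m S)) (G ∘ insertAt (suc p) m ∘ (x ∷_))
      insertUnderHead {x} (x∈S , m≢x) =
        ≡.subst (λ T → ∑Perm (suc k′) (remove x S) (G ∘ (x ∷_))
                       ≈ ∑[ p ∈ upTo (suc k′) ] ∑Perm k′ T (G ∘ insertAt (suc p) m ∘ (x ∷_)))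
                (remove-comm m x S)
                (∑Perm-insertAt k′ (remove x S) m (G ∘ (x ∷_)) (remove-unique x S uS)
                                (∈-remove⁺ m∈S (≡.≢-sym m≢x)) (ℕ.suc-injective (≡.trans (length-remove S uS x∈S) len′)))

  ∑Perm-*ˡ : ∀ k S a G → ∑Perm k S (λ w → a * G w) ≈ a * ∑Perm k S G
  ∑Perm-*ˡ k S = ∑-*ˡ (filter unique? (words k S))

  ∑Perm-0 : ∀ k S → ∑Perm k S (λ _ → 0#) ≈ 0#
  ∑Perm-0 k S = ∑-0 (filter unique? (words k S))

  words-shape : ∀ k S → All (λ w → length w ≡ k × All (_∈ S) w) (words k S)
  words-shape zero    S = (≡.refl , []) ∷ []
  words-shape (suc k) S = concat⁺ (map⁺ (All.tabulate (λ {x} x∈S →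
    map⁺ (All.map (λ (len , w⊆S) → ≡.cong suc len , x∈S ∷ w⊆S) (words-shape k S)))))

  ∑Perm-cong : ∀ k S {G G′ : List ℕ → Carrier} →
               (∀ w → length w ≡ k → All (_∈ S) w → Unique w → G w ≈ G′ w) →
               ∑Perm k S G ≈ ∑Perm k S G′
  ∑Perm-cong k S h = ∑-cong-∈ (filter unique? (words k S)) (λ w w∈ →
    let w∈words , uw = ∈-filter⁻ unique? {xs = words k S} w∈
        len , w⊆S    = All.lookup (words-shape k S) w∈words
    in h w len w⊆S uw)

  ∑-splits-∷ : (x : A) (xs : List A) (F : Split A → Carrier) →
               ∑ (splits (x ∷ xs)) F
               ≡ F (split [] x xs) + ∑[ s ∈ splits xs ] F (split (x ∷ before s) (pivot s) (after s))
  ∑-splits-∷ x xs F = ≡.cong (F (split [] x xs) +_) (∑-map _ (splits xs) F)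

  ∑-splits-align : (S : List A) (γ : List B) (X : Split A → Carrier) (Y : Split B → Carrier) →
    length S ≡ length γ →
    (∀ s g → length (before s) ≡ length (before g) → before s ++ pivot s ∷ after s ≡ S →
             before g ++ pivot g ∷ after g ≡ γ → X s ≈ Y g) →
    ∑ (splits S) X ≈ ∑ (splits γ) Y
  ∑-splits-align []      []      X Y _   _ = refl
  ∑-splits-align (x ∷ S) (b ∷ γ) X Y len h = begin
    ∑ (splits (x ∷ S)) X
      ≡⟨ ∑-splits-∷ x S X ⟩
    X (split [] x S) + ∑[ s ∈ splits S ] X (split (x ∷ before s) (pivot s) (after s))
      ≈⟨ +-cong (h _ _ ≡.refl ≡.refl ≡.refl)
                (∑-splits-align S γ _ _ (ℕ.suc-injective len)
                   (λ s g l eS eγ → h _ _ (≡.cong suc l) (≡.cong (x ∷_) eS) (≡.cong (b ∷_) eγ))) ⟩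
    Y (split [] b γ) + ∑[ g ∈ splits γ ] Y (split (b ∷ before g) (pivot g) (after g))
      ≡⟨ ∑-splits-∷ b γ Y ⟨
    ∑ (splits (b ∷ γ)) Y ∎

  ∑-remove-splits : ∀ S (F : ℕ → List ℕ → Carrier) → Unique S →
                    ∑[ y ∈ S ] F y (remove y S) ≈ ∑[ s ∈ splits S ] F (pivot s) (joined s)
  ∑-remove-splits []      F _          = refl
  ∑-remove-splits (x ∷ S) F (x∉S ∷ uS) = begin
    F x (remove x (x ∷ S)) + ∑[ y ∈ S ] F y (remove y (x ∷ S))
      ≈⟨ +-cong (reflexive (≡.cong (F x) (remove-head x S x∉S)))
                (∑-cong-∈ S (λ y y∈S →
                   reflexive (≡.cong (F y) (remove-∷-≢ S (≡.≢-sym (All.lookup x∉S y∈S)))))) ⟩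
    F x S + ∑[ y ∈ S ] F y (x ∷ remove y S)
      ≈⟨ +-cong refl (∑-remove-splits S (λ y T → F y (x ∷ T)) uS) ⟩
    F x S + ∑[ s ∈ splits S ] F (pivot s) (x ∷ joined s)
      ≡⟨ ∑-splits-∷ x S (λ s → F (pivot s) (joined s)) ⟨
    ∑[ s ∈ splits (x ∷ S) ] F (pivot s) (joined s) ∎

  pow-+ : ∀ x a b → pow R x (a ℕ.+ b) ≈ pow R x a * pow R x b
  pow-+ x zero    b = sym (*-identityˡ _)
  pow-+ x (suc a) b = trans (*-cong refl (pow-+ x a b)) (sym (*-assoc _ _ _))

  qint-suc : ∀ x h → qint R x (suc h) ≈ 1# + x * qint R x h
  qint-suc x h = trans (∑-upTo-suc h (pow R x)) (+-cong refl (∑-*ˡ (upTo h) x (pow R x)))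

  qint-snoc : ∀ x n → qint R x (suc n) ≈ qint R x n + pow R x n
  qint-snoc x n = begin
    ∑ (upTo (suc n)) (pow R x)            ≡⟨ ≡.cong (λ ps → ∑ ps (pow R x)) (upTo-∷ʳ n) ⟨
    ∑ (upTo n ++ n ∷ []) (pow R x)        ≈⟨ ∑-++ (upTo n) (n ∷ []) (pow R x) ⟩
    qint R x n + (pow R x n + 0#)         ≈⟨ +-cong refl (+-identityʳ _) ⟩
    qint R x n + pow R x n                ∎

  ∑-pow-∸ : ∀ x M → ∑[ p ∈ upTo (suc M) ] pow R x (M ∸ p) ≈ qint R x (suc M)
  ∑-pow-∸ x zero    = refl
  ∑-pow-∸ x (suc M) = begin
    ∑[ p ∈ upTo (suc (suc M)) ] pow R x (suc M ∸ p)         ≈⟨ ∑-upTo-suc (suc M) _ ⟩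
    pow R x (suc M) + ∑[ p ∈ upTo (suc M) ] pow R x (M ∸ p) ≈⟨ +-cong refl (∑-pow-∸ x M) ⟩
    pow R x (suc M) + qint R x (suc M)                      ≈⟨ +-comm _ _ ⟩
    qint R x (suc M) + pow R x (suc M)                      ≈⟨ qint-snoc x (suc M) ⟨
    qint R x (suc (suc M))                                  ∎

  prodR-++ : (f : A → Carrier) (xs ys : List A) →
             prodR R (map f (xs ++ ys)) ≈ prodR R (map f xs) * prodR R (map f ys)
  prodR-++ f []       ys = sym (*-identityˡ _)
  prodR-++ f (x ∷ xs) ys = trans (*-cong refl (prodR-++ f xs ys)) (sym (*-assoc _ _ _))

module DyckWeight {c ℓ} (R : CommutativeSemiring c ℓ) (q : CommutativeSemiring.Carrier R) where

  open CommutativeSemiring R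
  open import Relation.Binary.Reasoning.Setoid setoid
  open import Algebra.Properties.CommutativeSemigroup *-commutativeSemigroup
    using () renaming (x∙yz≈y∙xz to *-leftSwap)
  open Sums R

  -- ∏ [h_i]_q for a Dyck path from height h, and 0 for any other step sequence.
  dyckWeight : ℕ → List Bool → Carrier
  dyckWeight h       (true ∷ s)  = dyckWeight (suc h) s
  dyckWeight zero    []          = 1#
  dyckWeight (suc h) []          = 0#
  dyckWeight zero    (false ∷ s) = 0#
  dyckWeight (suc h) (false ∷ s) = qint R q (suc h) * dyckWeight h s

  dyckWeight-IsDyck : ∀ {h s} → DyckFrom h s → dyckWeight h s ≈ prodR R (map (qint R q) (downHeightsFrom h s))
  dyckWeight-IsDyck done     = refl
  dyckWeight-IsDyck (up d)   = dyckWeight-IsDyck d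
  dyckWeight-IsDyck (down d) = *-cong refl (dyckWeight-IsDyck d)

  downStepSum : (List Bool → Carrier) → List Bool → Carrier
  downStepSum f γ = ∑[ s ∈ splits γ ] iverson (not (pivot s)) (pow R q (downSteps (before s)) * f (joined s))

  -- At a first down step, [h + 1]_q = 1 + q [h]_q splits the sum into deleting this step
  -- (the 1) or a later one (the q [h]_q).
  dyckWeight-suc : ∀ h γ → dyckWeight (suc h) γ ≈ downStepSum (dyckWeight h) γ
  dyckWeight-suc h       []          = refl
  dyckWeight-suc h       (true ∷ γ)  = begin
    dyckWeight (suc (suc h)) γ              ≈⟨ dyckWeight-suc (suc h) γ ⟩
    downStepSum (dyckWeight (suc h)) γ      ≈⟨ +-identityˡ _ ⟨
    0# + downStepSum (dyckWeight (suc h)) γ ≡⟨ ∑-splits-∷ true γ _ ⟨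
    downStepSum (dyckWeight h) (true ∷ γ)   ∎
  dyckWeight-suc zero    (false ∷ γ) = begin
    qint R q 1 * dyckWeight 0 γ                        ≈⟨ *-cong (+-identityʳ 1#) refl ⟩
    1# * dyckWeight 0 γ                                ≈⟨ +-identityʳ _ ⟨
    1# * dyckWeight 0 γ + 0#                           ≈⟨ +-cong refl (sym laterVanish) ⟩
    1# * dyckWeight 0 γ + ∑[ s ∈ splits γ ] laterTerm s ≡⟨ ∑-splits-∷ false γ _ ⟨
    downStepSum (dyckWeight 0) (false ∷ γ)             ∎
    where
    laterTerm : Split Bool → Carrier
    laterTerm s = iverson (not (pivot s)) (pow R q (suc (downSteps (before s))) * dyckWeight 0 (false ∷ joined s))
    laterVanish : ∑[ s ∈ splits γ ] laterTerm s ≈ 0#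
    laterVanish = trans (∑-cong (splits γ) (λ s → trans (iverson-cong (not (pivot s)) (λ _ → zeroʳ _))
                                                          (iverson-0# (not (pivot s)))))
                        (∑-0 (splits γ))
  dyckWeight-suc (suc h) (false ∷ γ) = begin
    qint R q (suc (suc h)) * dyckWeight (suc h) γ
      ≈⟨ *-cong (qint-suc q (suc h)) refl ⟩
    (1# + q * [h+1]) * dyckWeight (suc h) γ
      ≈⟨ distribʳ _ _ _ ⟩
    1# * dyckWeight (suc h) γ + (q * [h+1]) * dyckWeight (suc h) γ
      ≈⟨ +-cong refl (*-cong refl (dyckWeight-suc h γ)) ⟩
    1# * dyckWeight (suc h) γ + (q * [h+1]) * downStepSum (dyckWeight h) γ
      ≈⟨ +-cong refl (∑-*ˡ (splits γ) _ _) ⟨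
    1# * dyckWeight (suc h) γ
      + ∑[ s ∈ splits γ ] ((q * [h+1]) * iverson (not (pivot s)) (pow R q (downSteps (before s)) * dyckWeight h (joined s)))
      ≈⟨ +-cong refl (∑-cong (splits γ) (λ s → trans (sym (iverson-*ˡ (not (pivot s)) _ _))
                                                       (iverson-cong (not (pivot s)) (λ _ → regroup _ _)))) ⟩
    1# * dyckWeight (suc h) γ
      + ∑[ s ∈ splits γ ] iverson (not (pivot s)) (pow R q (suc (downSteps (before s))) * dyckWeight (suc h) (false ∷ joined s))
      ≡⟨ ∑-splits-∷ false γ _ ⟨
    downStepSum (dyckWeight (suc h)) (false ∷ γ) ∎
    where
    [h+1] : Carrier
    [h+1] = qint R q (suc h)
    regroup : ∀ a b → (q * [h+1]) * (a * b) ≈ (q * a) * ([h+1] * b)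
    regroup a b = trans (*-assoc _ _ _) (trans (*-cong refl (*-leftSwap _ _ _)) (sym (*-assoc _ _ _)))

module GeneratingFunction {c ℓ} (R : CommutativeSemiring c ℓ) (q t : CommutativeSemiring.Carrier R) where

  open CommutativeSemiring R
  open import Relation.Binary.Reasoning.Setoid setoid
  open import Algebra.Properties.CommutativeSemigroup *-commutativeSemigroup
    using (interchange) renaming (x∙yz≈y∙xz to *-leftSwap)
  open Sums R
  open DyckWeight R q
  open import Data.List.Membership.Propositional.Properties using (∈-upTo⁻)

  samePath : List Bool → List Bool → Bool
  samePath α β = does (≡-dec Bool._≟_ α β)

  markedWeight : List (ℕ × Mark) → Carrier
  markedWeight M = pow R q (aaOf M) * pow R t (zOf M)

  weight : ℕ → List ℕ → Carrier
  weight f w = markedWeight (markedAfter f w)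

  aValuesAfter : ℕ → List ℕ → List ℕ
  aValuesAfter f w = aValues (markedAfter f w)

  gfTerm : ℕ → List ℕ → List Bool → List ℕ → Carrier
  gfTerm f S β w = iverson (samePath (pathOn S (aValuesAfter f w)) β) (weight f w)

  -- k is the length of the words, f the number of crossout rounds.
  gf : ℕ → ℕ → List ℕ → List Bool → Carrier
  gf k f S β = ∑Perm k S (gfTerm f S β)

  tProduct : ℕ → Carrier
  tProduct n = prodR R (map (λ k → qint R t (2 ℕ.* suc k)) (upTo n))

  tProduct-suc : ∀ n → tProduct (suc n) ≈ qint R t (2 ℕ.* suc n) * tProduct n
  tProduct-suc n = begin
    prodR R (map [2k+2] (upTo (suc n)))     ≡⟨ ≡.cong (prodR R ∘ map [2k+2]) (upTo-∷ʳ n) ⟨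
    prodR R (map [2k+2] (upTo n ++ n ∷ [])) ≈⟨ prodR-++ [2k+2] (upTo n) (n ∷ []) ⟩
    tProduct n * ([2k+2] n * 1#)            ≈⟨ *-comm _ _ ⟩
    ([2k+2] n * 1#) * tProduct n            ≈⟨ *-cong (*-identityʳ _) refl ⟩
    [2k+2] n * tProduct n                   ∎
    where
    [2k+2] : ℕ → Carrier
    [2k+2] k = qint R t (2 ℕ.* suc k)

  -- The term of insertAt p s (y ∷ v) without its factor t^(number of entries after s).
  headTerm : ℕ → List ℕ → List Bool → ℕ → List ℕ → Carrier
  headTerm f S β y v = iverson (samePath (true ∷ pathOn S (y ∷ aValuesAfter f v)) β)
                               (pow R q (countᵇ (_<ᵇ y) (aValuesAfter f v)) * weight f v)

  term-insertAt-minimum : ∀ f p s S y v β → p ≤ suc (length v) → s < y → All (s <_) v →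
    gfTerm (suc f) (s ∷ S) β (insertAt p s (y ∷ v)) ≈ pow R t (suc (length v) ∸ p) * headTerm f S β y v
  term-insertAt-minimum f p s S y v β hp s<y s<v = begin
    iverson (samePath (pathOn (s ∷ S) (aValues M)) β) (markedWeight M)
      ≡⟨ ≡.cong₂ (λ A M → iverson (samePath (pathOn (s ∷ S) A) β) (markedWeight M))
                 (≡.cong aValues eM) eM ⟩
    iverson (samePath (pathOn (s ∷ S) (aValues M′)) β) (markedWeight M′)
      ≡⟨ ≡.cong₂ (λ P k → iverson (samePath P β) (pow R q k * pow R t (zOf M′)))
                 (≡.trans (≡.cong (pathOn (s ∷ S)) (aValues-insertAt-pair p s y L)) (pathOn-least s S y A s<y s<A))
                 (≡.trans (aaOf-insertAt-pair p s y L) (≡.cong (ℕ._+ aaOf L) (aBelow-aValues y L))) ⟩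
    iverson b (pow R q (countᵇ (_<ᵇ y) A ℕ.+ aaOf L) * pow R t (zOf M′))
      ≡⟨ ≡.cong (λ k → iverson b (pow R q (countᵇ (_<ᵇ y) A ℕ.+ aaOf L) * pow R t k))
                (≡.trans (zOf-insertAt-pair p s y L s<y (All-zip v _ s<v)
                                            (≡.subst (λ k → p ≤ suc k) (≡.sym lenL) hp))
                         (≡.cong (λ k → (suc k ∸ p) ℕ.+ zOf L) lenL)) ⟩
    iverson b (pow R q (countᵇ (_<ᵇ y) A ℕ.+ aaOf L) * pow R t ((suc (length v) ∸ p) ℕ.+ zOf L))
      ≈⟨ iverson-cong b (λ _ → *-cong (pow-+ q (countᵇ (_<ᵇ y) A) (aaOf L))
                                      (pow-+ t (suc (length v) ∸ p) (zOf L))) ⟩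
    iverson b ((pow R q (countᵇ (_<ᵇ y) A) * pow R q (aaOf L)) * (pow R t (suc (length v) ∸ p) * pow R t (zOf L)))
      ≈⟨ iverson-cong b (λ _ → regroup _ _ _ _) ⟩
    iverson b (pow R t (suc (length v) ∸ p) * (pow R q (countᵇ (_<ᵇ y) A) * weight f v))
      ≈⟨ iverson-*ˡ b _ _ ⟩
    pow R t (suc (length v) ∸ p) * headTerm f S β y v ∎
    where
    M L M′ : List (ℕ × Mark)
    M    = markedAfter (suc f) (insertAt p s (y ∷ v))
    L    = markedAfter f v
    M′   = insertAt p (s , mB) ((y , mA) ∷ L)
    A : List ℕ
    A    = aValues L
    b : Bool
    b    = samePath (true ∷ pathOn S (y ∷ A)) β
    eM   : M ≡ M′
    eM   = markedAfter-insertAt-minimum f p s y v s<y s<v hp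
    lenL : length L ≡ length v
    lenL = length-markedAfter f v
    s<A  : All (s <_) A
    s<A  = All-aValues v _ s<v
    regroup : ∀ a b c d → (a * b) * (c * d) ≈ c * (a * (b * d))
    regroup a b c d = trans (interchange a b c d) (trans (*-cong (*-comm a c) refl) (*-assoc c a (b * d)))

  samePath-++-∷ : ∀ xs ys {b zs ws} → length xs ≡ length ys →
                  samePath (xs ++ b ∷ zs) (ys ++ b ∷ ws) ≡ samePath (xs ++ zs) (ys ++ ws)
  samePath-++-∷ []       []       {true}  _   = ≡.refl
  samePath-++-∷ []       []       {false} _   = ≡.refl
  samePath-++-∷ (x ∷ xs) (y ∷ ys)         len =
    ≡.cong (does (x Bool.≟ y) ∧_) (samePath-++-∷ xs ys (ℕ.suc-injective len))

  samePath-++-false∷-true∷ : ∀ xs ys {zs ws} → length xs ≡ length ys →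
                             samePath (xs ++ false ∷ zs) (ys ++ true ∷ ws) ≡ false
  samePath-++-false∷-true∷ []       []       _   = ≡.refl
  samePath-++-false∷-true∷ (x ∷ xs) (y ∷ ys) len =
    ≡.trans (≡.cong (does (x Bool.≟ y) ∧_) (samePath-++-false∷-true∷ xs ys (ℕ.suc-injective len))) (∧-zeroʳ _)

  samePath-sound : ∀ α β → samePath α β ≡ true → α ≡ β
  samePath-sound α β same with ≡-dec Bool._≟_ α β
  ... | yes α≡β = α≡β

  pivotTerm : ℕ → ℕ → List ℕ → List Bool → List ℕ → Carrier
  pivotTerm f y S γ v = iverson (samePath (pathOn S (y ∷ aValuesAfter f v)) γ)
                                (pow R q (countᵇ (_<ᵇ y) (aValuesAfter f v)) * weight f v)

  GfFormula : ℕ → ℕ → Set ℓ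
  GfFormula n f = ∀ S β → length S ≡ 2 ℕ.* n → Sorted S → length β ≡ 2 ℕ.* n →
                  gf (2 ℕ.* n) f S β ≈ tProduct n * dyckWeight 0 β

  -- y is an A-value, so its position is a down step of the path.
  ∑-pivotTerm-up : ∀ k f P y Q g₁ g₂ → length P ≡ length g₁ → All (_< y) P → All (y <_) Q →
                   ∑Perm k (P ++ Q) (pivotTerm f y (P ++ y ∷ Q) (g₁ ++ true ∷ g₂)) ≈ 0#
  ∑-pivotTerm-up k f P y Q g₁ g₂ len P<y y<Q =
    trans (∑Perm-cong k (P ++ Q) (λ v _ _ _ → reflexive (≡.cong (λ b → iverson b _) (noMatch v))))
          (∑Perm-0 k (P ++ Q))
    where
    noMatch : ∀ v → samePath (pathOn (P ++ y ∷ Q) (y ∷ aValuesAfter f v)) (g₁ ++ true ∷ g₂) ≡ false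
    noMatch v = ≡.trans (≡.cong (λ π → samePath π (g₁ ++ true ∷ g₂)) (pathOn-split P y Q A P<y y<Q))
                        (samePath-++-false∷-true∷ (pathOn P A) g₁ (≡.trans (length-pathOn P A) len))
      where
      A : List ℕ
      A = aValuesAfter f v

  -- Removing the down step of y leaves the path of v on P ++ Q, and the A-values below y
  -- correspond to the down steps before it.
  pivotTerm-down : ∀ f P y Q g₁ g₂ v → length P ≡ length g₁ → Sorted (P ++ y ∷ Q) →
                   All (_∈ P ++ Q) v → Unique v →
                   pivotTerm f y (P ++ y ∷ Q) (g₁ ++ false ∷ g₂) v
                   ≈ pow R q (downSteps g₁) * gfTerm f (P ++ Q) (g₁ ++ g₂) v
  pivotTerm-down f P y Q g₁ g₂ v len sorted v⊆PQ uv = begin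
    pivotTerm f y (P ++ y ∷ Q) (g₁ ++ false ∷ g₂) v
      ≡⟨ ≡.cong (λ b → iverson b (pow R q (countᵇ (_<ᵇ y) A) * weight f v)) sameShorter ⟩
    iverson b (pow R q (countᵇ (_<ᵇ y) A) * weight f v)
      ≈⟨ iverson-cong b (λ match → *-cong (reflexive (≡.cong (pow R q) (belowIsDown match))) refl) ⟩
    iverson b (pow R q (downSteps g₁) * weight f v)
      ≈⟨ iverson-*ˡ b _ _ ⟩
    pow R q (downSteps g₁) * iverson b (weight f v) ∎
    where
    A : List ℕ
    A = aValuesAfter f v
    b : Bool
    b = samePath (pathOn (P ++ Q) A) (g₁ ++ g₂)
    P<y : All (_< y) P
    P<y = proj₁ (Sorted-split P y Q sorted)
    y<Q : All (y <_) Q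
    y<Q = proj₁ (proj₂ (Sorted-split P y Q sorted))
    lenP : length (pathOn P A) ≡ length g₁
    lenP = ≡.trans (length-pathOn P A) len
    sameShorter : samePath (pathOn (P ++ y ∷ Q) (y ∷ A)) (g₁ ++ false ∷ g₂) ≡ b
    sameShorter = ≡.trans (≡.cong (λ π → samePath π (g₁ ++ false ∷ g₂)) (pathOn-split P y Q A P<y y<Q))
                  (≡.trans (samePath-++-∷ (pathOn P A) g₁ lenP)
                           (≡.cong (λ π → samePath π (g₁ ++ g₂)) (≡.sym (pathOn-++ P Q A))))
    belowIsDown : b ≡ true → countᵇ (_<ᵇ y) A ≡ downSteps g₁
    belowIsDown match =
      ≡.trans (≡.sym (downSteps-pathOn-prefix P y Q A P<y y<Q (Sorted⇒Unique (Sorted-++⁻ˡ P sorted))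
                                            (aValues-unique v _ uv) (All-aValues v _ v⊆PQ)))
              (≡.cong downSteps (proj₁ (++-cancel-≡length (pathOn P A) g₁ lenP
                 (≡.trans (≡.sym (pathOn-++ P Q A)) (samePath-sound _ _ match)))))

  ∑-pivotTerm-down : ∀ n f → GfFormula n f → ∀ P y Q g₁ g₂ → length P ≡ length g₁ →
    Sorted (P ++ y ∷ Q) →
    length (P ++ y ∷ Q) ≡ suc (2 ℕ.* n) → length (g₁ ++ false ∷ g₂) ≡ suc (2 ℕ.* n) →
    ∑Perm (2 ℕ.* n) (P ++ Q) (pivotTerm f y (P ++ y ∷ Q) (g₁ ++ false ∷ g₂))
    ≈ pow R q (downSteps g₁) * (tProduct n * dyckWeight 0 (g₁ ++ g₂))
  ∑-pivotTerm-down n f gfFormula P y Q g₁ g₂ len sorted lenS lenγ = begin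
    ∑Perm (2 ℕ.* n) (P ++ Q) (pivotTerm f y (P ++ y ∷ Q) (g₁ ++ false ∷ g₂))
      ≈⟨ ∑Perm-cong (2 ℕ.* n) (P ++ Q) (λ v _ v⊆PQ uv → pivotTerm-down f P y Q g₁ g₂ v len sorted v⊆PQ uv) ⟩
    ∑Perm (2 ℕ.* n) (P ++ Q) (λ v → pow R q (downSteps g₁) * gfTerm f (P ++ Q) (g₁ ++ g₂) v)
      ≈⟨ ∑Perm-*ˡ (2 ℕ.* n) (P ++ Q) _ _ ⟩
    pow R q (downSteps g₁) * gf (2 ℕ.* n) f (P ++ Q) (g₁ ++ g₂)
      ≈⟨ *-cong refl (gfFormula (P ++ Q) (g₁ ++ g₂) (length-++-∷ P lenS)
                                (proj₂ (proj₂ (Sorted-split P y Q sorted))) (length-++-∷ g₁ lenγ)) ⟩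
    pow R q (downSteps g₁) * (tProduct n * dyckWeight 0 (g₁ ++ g₂)) ∎

  ∑-pivotTerm : ∀ n f → GfFormula n f → ∀ P y Q g₁ b g₂ → length P ≡ length g₁ →
    Sorted (P ++ y ∷ Q) →
    length (P ++ y ∷ Q) ≡ suc (2 ℕ.* n) → length (g₁ ++ b ∷ g₂) ≡ suc (2 ℕ.* n) →
    ∑Perm (2 ℕ.* n) (P ++ Q) (pivotTerm f y (P ++ y ∷ Q) (g₁ ++ b ∷ g₂))
    ≈ iverson (not b) (pow R q (downSteps g₁) * (tProduct n * dyckWeight 0 (g₁ ++ g₂)))
  ∑-pivotTerm n f gfFormula P y Q g₁ true g₂ len sorted _ _ =
    ∑-pivotTerm-up (2 ℕ.* n) f P y Q g₁ g₂ len (proj₁ (Sorted-split P y Q sorted))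
                   (proj₁ (proj₂ (Sorted-split P y Q sorted)))
  ∑-pivotTerm n f gfFormula P y Q g₁ false g₂ len sorted lenS lenγ =
    ∑-pivotTerm-down n f gfFormula P y Q g₁ g₂ len sorted lenS lenγ

  -- Summing over y amounts to summing over the down steps of the tail of β, as in dyckWeight-suc.
  ∑-headTerms : ∀ n f → GfFormula n f → ∀ S β → length S ≡ suc (2 ℕ.* n) → Sorted S →
                length β ≡ suc (suc (2 ℕ.* n)) →
                ∑[ y ∈ S ] ∑Perm (2 ℕ.* n) (remove y S) (headTerm f S β y) ≈ tProduct n * dyckWeight 0 β
  ∑-headTerms n f gfFormula S (false ∷ β) _ _ _ =
    trans (trans (∑-cong S (λ y → ∑Perm-0 (2 ℕ.* n) (remove y S))) (∑-0 S)) (sym (zeroʳ _))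
  ∑-headTerms n f gfFormula S (true ∷ γ) lenS sorted lenβ = begin
    ∑[ y ∈ S ] ∑Perm k (remove y S) (pivotTerm f y S γ)
      ≈⟨ ∑-remove-splits S (λ y T → ∑Perm k T (pivotTerm f y S γ)) (Sorted⇒Unique sorted) ⟩
    ∑[ s ∈ splits S ] ∑Perm k (joined s) (pivotTerm f (pivot s) S γ)
      ≈⟨ ∑-splits-align S γ _ _ (≡.trans lenS (≡.sym lenγ)) atSameIndex ⟩
    ∑[ g ∈ splits γ ] iverson (not (pivot g)) (pow R q (downSteps (before g)) * (tProduct n * dyckWeight 0 (joined g)))
      ≈⟨ ∑-cong (splits γ) (λ g → trans (iverson-cong (not (pivot g)) (λ _ → *-leftSwap _ _ _))
                                         (iverson-*ˡ _ _ _)) ⟩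
    ∑[ g ∈ splits γ ] (tProduct n * iverson (not (pivot g)) (pow R q (downSteps (before g)) * dyckWeight 0 (joined g)))
      ≈⟨ ∑-*ˡ (splits γ) (tProduct n) _ ⟩
    tProduct n * downStepSum (dyckWeight 0) γ
      ≈⟨ *-cong refl (dyckWeight-suc 0 γ) ⟨
    tProduct n * dyckWeight 0 (true ∷ γ) ∎
    where
    k : ℕ
    k = 2 ℕ.* n
    lenγ : length γ ≡ suc k
    lenγ = ℕ.suc-injective lenβ
    atSameIndex : ∀ s g → length (before s) ≡ length (before g) → before s ++ pivot s ∷ after s ≡ S →
                  before g ++ pivot g ∷ after g ≡ γ →
                  ∑Perm k (joined s) (pivotTerm f (pivot s) S γ)
                  ≈ iverson (not (pivot g)) (pow R q (downSteps (before g)) * (tProduct n * dyckWeight 0 (joined g)))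
    atSameIndex (split P y Q) (split g₁ b g₂) len eS eγ =
      ≡.subst₂ (λ S′ γ′ → ∑Perm k (P ++ Q) (pivotTerm f y S′ γ′)
                          ≈ iverson (not b) (pow R q (downSteps g₁) * (tProduct n * dyckWeight 0 (g₁ ++ g₂))))
               eS eγ
               (∑-pivotTerm n f gfFormula P y Q g₁ b g₂ len (≡.subst Sorted (≡.sym eS) sorted)
                            (≡.trans (≡.cong length eS) lenS) (≡.trans (≡.cong length eγ) lenγ))

  -- With s at position p, the z-statistic grows by the number k + 1 - p of entries after s,
  -- which produces [k + 2]_t.
  gf-step : ∀ n f → GfFormula n f → ∀ s S β → length (s ∷ S) ≡ suc (suc (2 ℕ.* n)) → Sorted (s ∷ S) →
            length β ≡ suc (suc (2 ℕ.* n)) →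
            gf (suc (suc (2 ℕ.* n))) (suc f) (s ∷ S) β
            ≈ qint R t (suc (suc (2 ℕ.* n))) * (tProduct n * dyckWeight 0 β)
  gf-step n f gfFormula s S β lenS sorted@(s<S AllPairs.∷ sortedS) lenβ = begin
    ∑Perm (suc (suc k)) (s ∷ S) G
      ≈⟨ ∑Perm-insertAt (suc k) (s ∷ S) s G (Sorted⇒Unique sorted) (here ≡.refl) lenS ⟩
    ∑[ p ∈ upTo (suc (suc k)) ] ∑Perm (suc k) (remove s (s ∷ S)) (G ∘ insertAt p s)
      ≡⟨ ≡.cong (λ S′ → ∑[ p ∈ upTo (suc (suc k)) ] ∑Perm (suc k) S′ (G ∘ insertAt p s))
                (remove-head s S (All.map (λ s<y s≡y → ℕ.<-irrefl s≡y s<y) s<S)) ⟩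
    ∑[ p ∈ upTo (suc (suc k)) ] ∑Perm (suc k) S (G ∘ insertAt p s)
      ≈⟨ ∑-cong (upTo (suc (suc k))) (λ p → ∑Perm-suc k S (G ∘ insertAt p s)) ⟩
    ∑[ p ∈ upTo (suc (suc k)) ] ∑[ y ∈ S ] ∑Perm k (remove y S) (λ v → G (insertAt p s (y ∷ v)))
      ≈⟨ ∑-cong-∈ (upTo (suc (suc k))) (λ p p∈ → ∑-cong-∈ S (λ y y∈S →
           ∑Perm-cong k (remove y S) (λ v lenv v⊆ _ → term p y v (∈-upTo⁻ p∈) y∈S lenv v⊆))) ⟩
    ∑[ p ∈ upTo (suc (suc k)) ] ∑[ y ∈ S ] ∑Perm k (remove y S) (λ v → pow R t (suc k ∸ p) * headTerm f S β y v)
      ≈⟨ ∑-cong (upTo (suc (suc k))) (λ p →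
           trans (∑-cong S (λ y → ∑Perm-*ˡ k (remove y S) _ _)) (∑-*ˡ S _ _)) ⟩
    ∑[ p ∈ upTo (suc (suc k)) ] (pow R t (suc k ∸ p) * heads)
      ≈⟨ ∑-*ʳ (upTo (suc (suc k))) _ heads ⟩
    ∑[ p ∈ upTo (suc (suc k)) ] pow R t (suc k ∸ p) * heads
      ≈⟨ *-cong (∑-pow-∸ t (suc k)) (∑-headTerms n f gfFormula S β (ℕ.suc-injective lenS) sortedS lenβ) ⟩
    qint R t (suc (suc k)) * (tProduct n * dyckWeight 0 β) ∎
    where
    k : ℕ
    k = 2 ℕ.* n
    G : List ℕ → Carrier
    G = gfTerm (suc f) (s ∷ S) β
    heads : Carrier
    heads = ∑[ y ∈ S ] ∑Perm k (remove y S) (headTerm f S β y)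
    term : ∀ p y v → p < suc (suc k) → y ∈ S → length v ≡ k → All (_∈ remove y S) v →
           G (insertAt p s (y ∷ v)) ≈ pow R t (suc k ∸ p) * headTerm f S β y v
    term p y v p<k+2 y∈S lenv v⊆ =
      ≡.subst (λ l → G (insertAt p s (y ∷ v)) ≈ pow R t (suc l ∸ p) * headTerm f S β y v) lenv
        (term-insertAt-minimum f p s S y v β (≡.subst (λ l → p ≤ suc l) (≡.sym lenv) (ℕ.≤-pred p<k+2))
                               (All.lookup s<S y∈S)
                               (All.map (λ x∈ → All.lookup s<S (proj₁ (∈-remove⁻ {m = y} {S = S} x∈))) v⊆))

  gf-sorted : ∀ n f → n ℕ.≤ f → GfFormula n f
  gf-sorted zero    f       _         []      []      _    _      _    = +-identityʳ (1# * 1#)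
  gf-sorted (suc n) (suc f) (s≤s n≤f) (s ∷ S) β lenS sorted lenβ = begin
    gf (2 ℕ.* suc n) (suc f) (s ∷ S) β
      ≡⟨ ≡.cong (λ k → gf k (suc f) (s ∷ S) β) (ℕ.*-suc 2 n) ⟩
    gf (suc (suc (2 ℕ.* n))) (suc f) (s ∷ S) β
      ≈⟨ gf-step n f (gf-sorted n f n≤f) s S β (≡.trans lenS (ℕ.*-suc 2 n)) sorted
                 (≡.trans lenβ (ℕ.*-suc 2 n)) ⟩
    qint R t (suc (suc (2 ℕ.* n))) * (tProduct n * dyckWeight 0 β)
      ≡⟨ ≡.cong (λ k → qint R t k * (tProduct n * dyckWeight 0 β)) (ℕ.*-suc 2 n) ⟨
    qint R t (2 ℕ.* suc n) * (tProduct n * dyckWeight 0 β)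
      ≈⟨ *-assoc _ _ _ ⟨
    (qint R t (2 ℕ.* suc n) * tProduct n) * dyckWeight 0 β
      ≈⟨ *-cong (tProduct-suc n) refl ⟨
    tProduct (suc n) * dyckWeight 0 β ∎

  lhs-as-gf : ∀ n α → lhs R q t n α ≈ gf (2 ℕ.* n) (2 ℕ.* n) (range1 (2 ℕ.* n)) α
  lhs-as-gf n α = trans (∑-filter (λ w → ≡-dec Bool._≟_ (pathA w) α) (perms (2 ℕ.* n)) _)
                        (∑Perm-cong (2 ℕ.* n) (range1 (2 ℕ.* n)) sameLength)
    where
    sameLength : ∀ w → length w ≡ 2 ℕ.* n → All (_∈ range1 (2 ℕ.* n)) w → Unique w →
                 iverson (samePath (pathA w) α) (pow R q (aa w) * pow R t (zstat w))
                 ≈ gfTerm (2 ℕ.* n) (range1 (2 ℕ.* n)) α w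
    sameLength w len _ _ =
      reflexive (≡.cong (λ m → gfTerm m (range1 m) α w) len)

  lhs≈rhs : ∀ n α → length α ≡ 2 ℕ.* n → IsDyck α → lhs R q t n α ≈ rhs R q t n α
  lhs≈rhs n α lenα dyck = begin
    lhs R q t n α
      ≈⟨ lhs-as-gf n α ⟩
    gf (2 ℕ.* n) (2 ℕ.* n) (range1 (2 ℕ.* n)) α
      ≈⟨ gf-sorted n (2 ℕ.* n) (ℕ.m≤m+n n (n ℕ.+ 0)) (range1 (2 ℕ.* n)) α
                   (length-range1 (2 ℕ.* n)) (Sorted-range1 (2 ℕ.* n)) lenα ⟩
    tProduct n * dyckWeight 0 α
      ≈⟨ *-cong refl (dyckWeight-IsDyck dyck) ⟩
    rhs R q t n α ∎

open import Data.Nat using (_≥_; _*_)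

-- The identity also holds for n = 0.
theorem6 : ∀ {c ℓ} (R : CommutativeSemiring c ℓ) (q t : CommutativeSemiring.Carrier R)
           (n : ℕ) → n ≥ 1 → (α : List Bool) → length α ≡ 2 * n → IsDyck α →
           CommutativeSemiring._≈_ R (lhs R q t n α) (rhs R q t n α)
theorem6 R q t n _ α lenα dyck = GeneratingFunction.lhs≈rhs R q t n α lenα dyck
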